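{- Let $p,q$ be complex numbers with $p^2-4q\neq0$, let $k$ be a positive integer with $U_k(p,q)\ne0$, and let $d\ge1$. Then for every integer $n\ge d$, $$\sum_{j=0}^{d}(4q^k)^{d-j}\Big(\sum_{i=0}^{j}(-1)^i\binom{j}{i}(j+1-i)^d\Big)\Big(\frac{V_k^2(p,q)-4q^k}{U_k(p,q)}\Big)^{j}s_{j+1}(n+j-d;p,q;k)$$ $$=\sum_{j=1}^{d}\frac{(-1)^{d-1}(2q^k)^{d-j}}{(j-1)!}\Big(\sum_{i=0}^{j-1}(-1)^i\binom{j-1}{i}(i+1)^{d-1}\Big)\Big(\sum_{s=0}^{j}\binom{j}{s}v_{d,j,s}(n)\,U_{(n+j-d-s)k}(p,q)\Big),$$ where $v_{d,j,s}(n)=(-2q^k)^sV_k^{j-s}(p,q)\prod_{i=1}^{j}(n+j-d-s-i)$.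
   Context: For complex $p,q$ with $p^2-4q\ne0$, put $\alpha=\frac12(p+\sqrt{p^2-4q})$, $\beta=\frac12(p-\sqrt{p^2-4q})$, and for $n\ge0$ define $U_n(p,q)=\frac{\alpha^n-\beta^n}{\alpha-\beta}$ and $V_n(p,q)=\alpha^n+\beta^n$. For integers $d\ge1$, $n\ge0$ and positive integer $k$ define $$s_d(n;p,q;k)=\sum_{\substack{j_1+\cdots+j_d=n\\ j_1,\dots,j_d\ge0}}\ \prod_{i=1}^{d}U_{k j_i}(p,q).$$ -}

module Defs where

open import Level using (Level; _⊔_) renaming (suc to lsuc)
open import Algebra.Bundles using (CommutativeRing)
open import Data.Nat as ℕ using (ℕ; zero; suc; _∸_)
open import Data.Nat.Combinatorics using (_C_)
open import Data.Nat using (_!)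
open import Relation.Nullary using (¬_)
open import Data.Empty using (⊥)
open import Data.Nat.Properties using (_!≢0)

module RingOps {c ℓ : Level} (R : CommutativeRing c ℓ) where
  open CommutativeRing R

  ι : ℕ → Carrier
  ι zero    = 0#
  ι (suc n) = 1# + ι n

  infixr 8 _^_
  _^_ : Carrier → ℕ → Carrier
  x ^ zero  = 1#
  x ^ suc n = x * (x ^ n)

  Σ0 : ℕ → (ℕ → Carrier) → Carrier
  Σ0 zero    f = f 0
  Σ0 (suc n) f = Σ0 n f + f (suc n)

  Σ1 : ℕ → (ℕ → Carrier) → Carrier
  Σ1 zero    f = 0#
  Σ1 (suc n) f = Σ1 n f + f (suc n)

  Π1 : ℕ → (ℕ → Carrier) → Carrier
  Π1 zero    f = 1#
  Π1 (suc n) f = Π1 n f * f (suc n)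

  -- Σ over j_1 + ... + j_d = n (j_i ≥ 0) of ∏_{i=1}^{d} f (j_i)
  compSum : ℕ → ℕ → (ℕ → Carrier) → Carrier
  compSum zero    zero    f = 1#
  compSum zero    (suc n) f = 0#
  compSum (suc d) n       f = Σ0 n (λ j → f j * compSum d (n ∸ j) f)

record Char0Field (c ℓ : Level) : Set (lsuc (c ⊔ ℓ)) where
  field
    cring : CommutativeRing c ℓ
  open CommutativeRing cring public
  open RingOps cring public
  field
    inv      : (x : Carrier) → ¬ (x ≈ 0#) → Carrier
    inverseʳ : (x : Carrier) (nz : ¬ (x ≈ 0#)) → x * inv x nz ≈ 1#
    char0    : (n : ℕ) → ¬ (ι (suc n) ≈ 0#)

module FieldOps {c ℓ : Level} (F : Char0Field c ℓ) where
  open Char0Field F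

  sqrt-nz : (p q δ : Carrier) → δ * δ ≈ p * p - ι 4 * q →
            ¬ (p * p - ι 4 * q ≈ 0#) → ¬ (δ ≈ 0#)
  sqrt-nz p q δ sq disc δ≈0 =
    disc (trans (sym sq) (trans (*-congʳ δ≈0) (zeroˡ δ)))

  ι-nz : (m : ℕ) → .{{ℕ.NonZero m}} → ¬ (ι m ≈ 0#)
  ι-nz (suc m) = char0 m

  half : Carrier
  half = inv (ι 2) (char0 1)

  invFact : ℕ → Carrier
  invFact m = inv (ι (m !)) (ι-nz (m !) {{m !≢0}})

  -- With δ a square root of p² - 4q (δ ≉ 0):
  -- α = (p + δ)/2, β = (p - δ)/2,
  -- U_n = (αⁿ - βⁿ)/(α - β) where α - β = δ, V_n = αⁿ + βⁿ.
  module Lucas (p q δ : Carrier) (δnz : ¬ (δ ≈ 0#)) where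
    α β : Carrier
    α = (p + δ) * half
    β = (p - δ) * half

    U V : ℕ → Carrier
    U n = (α ^ n - β ^ n) * inv δ δnz
    V n = α ^ n + β ^ n

    s : ℕ → ℕ → ℕ → Carrier
    s d n k = compSum d n (λ j → U (k ℕ.* j))

module Submission where

-- Put P = V_k, Q = q^k and Δ = P² - 4Q. Then U_{mk} = U_k u_m for the Lucas sequence u of (P, Q),
-- so both sides are U_k times coefficients of power series built from F = Σ u_{n+1} xⁿ, which
-- satisfies (1 - P x + Q x²) F = 1. For g = P - 2Q x the derivation Θ = g · D, D = d/dx, gives
-- Θ F = 4Q F + Δ F², hence Θ (j! Δʲ F^{j+1}) = (j+1) 4Q · j! Δʲ F^{j+1} + (j+1)! Δ^{j+1} F^{j+2},
-- and likewise Θ (g^{j+1} D^{j+1} F) = (j+1) (-2Q) · g^{j+1} D^{j+1} F + g^{j+2} D^{j+2} F.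
-- Iterating such a raising relation produces r-Stirling coefficients (here r = 1), so Θᵈ F has
-- one expansion in each family. Reading off a coefficient of both expansions gives the identity,
-- once the explicit formula j! S_r(d, j) = Σᵢ (-1)^{j-i} (j choose i) (i + r)ᵈ turns the Stirling
-- numbers into the alternating sums of the statement.

open import Defs
open import Level using (Level; _⊔_)
open import Algebra.Bundles using (CommutativeRing)
open import Data.Nat as ℕ using (ℕ; zero; suc; _≤_; _<_; z≤n; s≤s; _∸_; _!) renaming (_+_ to _+ℕ_; _*_ to _*ℕ_; _^_ to _^ℕ_)
import Data.Nat.Properties as ℕ
open import Data.Nat.Combinatorics using (_C_; k>n⇒nCk≡0; nCk+nC[k+1]≡[n+1]C[k+1]; nC1≡n; nCk≡nC[n∸k])
open import Data.Integer as ℤ using (ℤ; +_; -[1+_]; _⊖_)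
import Data.Integer.Properties as ℤ
open import Data.Sign as Sign using (Sign)
open import Data.Maybe using (Maybe; just; nothing)
open import Data.Sum using (inj₁; inj₂)
open import Data.Product using (_,_)
open import Relation.Nullary using (¬_; yes; no)
open import Data.Nat.GeneralisedArithmetic using (iterate; iterate-is-fold)
import Relation.Binary.PropositionalEquality as ≡
import Algebra.Solver.Ring.AlmostCommutativeRing as AlmostCommutativeRing
import Algebra.Solver.Ring

module IntegerCoefficientSolver {c ℓ : Level} (R : CommutativeRing c ℓ) where
  open CommutativeRing R
  open import Algebra.Properties.Ring ring using (-‿involutive; -‿+-comm; -0#≈0#; -1*x≈-x)
  open import Algebra.Properties.CommutativeSemigroup +-commutativeSemigroup using (interchange)
  open import Algebra.Properties.CommutativeSemigroup *-commutativeSemigroup using () renaming (interchange to *-interchange)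
  open import Algebra.Properties.Semiring.Mult.TCOptimised semiring using (_×_; 1+×; ×-homo-+; ×1-homo-*)
  open import Relation.Binary.Reasoning.Setoid setoid

  -- With the optimised _×_ the solver's constants 0 and 1 evaluate to 0# and 1# on the nose.
  ⟦_⟧ : ℤ → Carrier
  ⟦ + n ⟧      = n × 1#
  ⟦ -[1+ n ] ⟧ = - (suc n × 1#)

  ⟦⊖⟧ : ∀ m n → ⟦ m ⊖ n ⟧ ≈ m × 1# - n × 1#
  ⟦⊖⟧ m zero = begin
    ⟦ m ⊖ 0 ⟧        ≡⟨ ≡.cong ⟦_⟧ (ℤ.⊖-≥ {m} ℕ.z≤n) ⟩
    m × 1#           ≈⟨ +-identityʳ _ ⟨
    m × 1# + 0#      ≈⟨ +-congˡ -0#≈0# ⟨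
    m × 1# - 0 × 1#  ∎
  ⟦⊖⟧ zero (suc n) = sym (+-identityˡ _)
  ⟦⊖⟧ (suc m) (suc n) = begin
    ⟦ suc m ⊖ suc n ⟧              ≡⟨ ≡.cong ⟦_⟧ (ℤ.[1+m]⊖[1+n]≡m⊖n m n) ⟩
    ⟦ m ⊖ n ⟧                      ≈⟨ ⟦⊖⟧ m n ⟩
    a - b                          ≈⟨ +-identityˡ _ ⟨
    0# + (a - b)                   ≈⟨ +-congʳ (-‿inverseʳ 1#) ⟨
    (1# - 1#) + (a - b)            ≈⟨ interchange 1# (- 1#) a (- b) ⟩
    (1# + a) + (- 1# + - b)        ≈⟨ +-cong (1+× m 1#) (trans (-‿cong (1+× n 1#)) (sym (-‿+-comm 1# b))) ⟨
    suc m × 1# - suc n × 1#        ∎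
    where a = m × 1#; b = n × 1#

  ⟦+⟧ : ∀ i j → ⟦ i ℤ.+ j ⟧ ≈ ⟦ i ⟧ + ⟦ j ⟧
  ⟦+⟧ (+ m)      (+ n)      = ×-homo-+ 1# m n
  ⟦+⟧ (+ m)      -[1+ n ]   = ⟦⊖⟧ m (suc n)
  ⟦+⟧ -[1+ m ]   (+ n)      = trans (⟦⊖⟧ n (suc m)) (+-comm _ _)
  ⟦+⟧ -[1+ m ]   -[1+ n ]   = begin
    - (suc (suc (m ℕ.+ n)) × 1#)        ≡⟨ ≡.cong (λ k → - (k × 1#)) (ℕ.+-suc (suc m) n) ⟨
    - ((suc m ℕ.+ suc n) × 1#)          ≈⟨ -‿cong (×-homo-+ 1# (suc m) (suc n)) ⟩
    - (suc m × 1# + suc n × 1#)         ≈⟨ -‿+-comm _ _ ⟨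
    - (suc m × 1#) + - (suc n × 1#)     ∎

  ⟦-⟧ : ∀ i → ⟦ ℤ.- i ⟧ ≈ - ⟦ i ⟧
  ⟦-⟧ (+ zero)    = sym -0#≈0#
  ⟦-⟧ (+ suc n)   = refl
  ⟦-⟧ -[1+ n ]    = sym (-‿involutive _)

  ⟦sign⟧ : Sign → Carrier
  ⟦sign⟧ Sign.+ = 1#
  ⟦sign⟧ Sign.- = - 1#

  ⟦sign⟧-* : ∀ s t → ⟦sign⟧ (s Sign.* t) ≈ ⟦sign⟧ s * ⟦sign⟧ t
  ⟦sign⟧-* Sign.+ t      = sym (*-identityˡ _)
  ⟦sign⟧-* Sign.- Sign.+ = sym (*-identityʳ _)
  ⟦sign⟧-* Sign.- Sign.- = sym (trans (-1*x≈-x _) (-‿involutive 1#))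

  ⟦◃⟧ : ∀ s n → ⟦ s ℤ.◃ n ⟧ ≈ ⟦sign⟧ s * n × 1#
  ⟦◃⟧ s      zero    = sym (zeroʳ _)
  ⟦◃⟧ Sign.+ (suc n) = sym (*-identityˡ _)
  ⟦◃⟧ Sign.- (suc n) = sym (-1*x≈-x _)

  ⟦⟧-signAbs : ∀ i → ⟦ i ⟧ ≈ ⟦sign⟧ (ℤ.sign i) * ℤ.∣ i ∣ × 1#
  ⟦⟧-signAbs i = trans (reflexive (≡.cong ⟦_⟧ (≡.sym (ℤ.◃-inverse i)))) (⟦◃⟧ (ℤ.sign i) ℤ.∣ i ∣)

  ⟦*⟧ : ∀ i j → ⟦ i ℤ.* j ⟧ ≈ ⟦ i ⟧ * ⟦ j ⟧
  ⟦*⟧ i j = begin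
    ⟦ i ℤ.* j ⟧                                            ≈⟨ ⟦◃⟧ (ℤ.sign i Sign.* ℤ.sign j) (ℤ.∣ i ∣ ℕ.* ℤ.∣ j ∣) ⟩
    ⟦sign⟧ (ℤ.sign i Sign.* ℤ.sign j) * (ℤ.∣ i ∣ ℕ.* ℤ.∣ j ∣) × 1#
                                                          ≈⟨ *-cong (⟦sign⟧-* (ℤ.sign i) (ℤ.sign j)) (×1-homo-* ℤ.∣ i ∣ ℤ.∣ j ∣) ⟩
    (⟦sign⟧ (ℤ.sign i) * ⟦sign⟧ (ℤ.sign j)) * (ℤ.∣ i ∣ × 1# * ℤ.∣ j ∣ × 1#)
                                                          ≈⟨ *-interchange _ _ _ _ ⟩
    (⟦sign⟧ (ℤ.sign i) * ℤ.∣ i ∣ × 1#) * (⟦sign⟧ (ℤ.sign j) * ℤ.∣ j ∣ × 1#)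
                                                          ≈⟨ *-cong (⟦⟧-signAbs i) (⟦⟧-signAbs j) ⟨
    ⟦ i ⟧ * ⟦ j ⟧                                          ∎

  homomorphism : ℤ.+-*-rawRing AlmostCommutativeRing.-Raw-AlmostCommutative⟶ AlmostCommutativeRing.fromCommutativeRing R
  homomorphism = record
    { ⟦_⟧ = ⟦_⟧ ; +-homo = ⟦+⟧ ; *-homo = ⟦*⟧ ; -‿homo = ⟦-⟧ ; 0-homo = refl ; 1-homo = refl }

  ⟦⟧-equal? : ∀ i j → Maybe (⟦ i ⟧ ≈ ⟦ j ⟧)
  ⟦⟧-equal? i j with i ℤ.≟ j
  ... | yes ≡.refl = just refl
  ... | no _     = nothing

  open Algebra.Solver.Ring ℤ.+-*-rawRing (AlmostCommutativeRing.fromCommutativeRing R) homomorphism ⟦⟧-equal? public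
    using (solve; _:=_; con; _:+_; _:*_; :-_; _:-_)

module RingOpsProperties {c ℓ : Level} (A : CommutativeRing c ℓ) where
  open CommutativeRing A
  open RingOps A
  open import Algebra.Properties.Ring ring using (-‿+-comm; -1*x≈-x; -‿involutive)
  open import Algebra.Properties.CommutativeSemigroup +-commutativeSemigroup using (interchange)
  open import Algebra.Properties.CommutativeSemigroup *-commutativeSemigroup using () renaming (interchange to *-interchange)
  open import Relation.Binary.Reasoning.Setoid setoid

  Σ0-cong : ∀ n {f g : ℕ → Carrier} → (∀ i → i ≤ n → f i ≈ g i) → Σ0 n f ≈ Σ0 n g
  Σ0-cong zero    f≈g = f≈g 0 z≤n
  Σ0-cong (suc n) f≈g = +-cong (Σ0-cong n (λ i i≤n → f≈g i (ℕ.m≤n⇒m≤1+n i≤n))) (f≈g (suc n) ℕ.≤-refl)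

  Σ0-distrib-+ : ∀ n (f g : ℕ → Carrier) → Σ0 n (λ i → f i + g i) ≈ Σ0 n f + Σ0 n g
  Σ0-distrib-+ zero    f g = refl
  Σ0-distrib-+ (suc n) f g = trans (+-congʳ (Σ0-distrib-+ n f g)) (interchange _ _ _ _)

  *-distribˡ-Σ0 : ∀ n a (f : ℕ → Carrier) → a * Σ0 n f ≈ Σ0 n (λ i → a * f i)
  *-distribˡ-Σ0 zero    a f = refl
  *-distribˡ-Σ0 (suc n) a f = trans (distribˡ _ _ _) (+-congʳ (*-distribˡ-Σ0 n a f))

  -‿distrib-Σ0 : ∀ n (f : ℕ → Carrier) → - Σ0 n f ≈ Σ0 n (λ i → - f i)
  -‿distrib-Σ0 zero    f = refl
  -‿distrib-Σ0 (suc n) f = trans (sym (-‿+-comm _ _)) (+-congʳ (-‿distrib-Σ0 n f))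

  Σ0-zero : ∀ n (f : ℕ → Carrier) → (∀ i → i ≤ n → f i ≈ 0#) → Σ0 n f ≈ 0#
  Σ0-zero zero    f f≈0 = f≈0 0 z≤n
  Σ0-zero (suc n) f f≈0 = trans (+-cong (Σ0-zero n f (λ i i≤n → f≈0 i (ℕ.m≤n⇒m≤1+n i≤n))) (f≈0 (suc n) ℕ.≤-refl)) (+-identityˡ _)

  Σ0-suc : ∀ n (f : ℕ → Carrier) → Σ0 (suc n) f ≈ f 0 + Σ0 n (λ i → f (suc i))
  Σ0-suc zero    f = refl
  Σ0-suc (suc n) f = trans (+-congʳ (Σ0-suc n f)) (+-assoc _ _ _)

  Σ0-extend : ∀ {m} n (f : ℕ → Carrier) → m ≤ n → (∀ i → m < i → i ≤ n → f i ≈ 0#) → Σ0 n f ≈ Σ0 m f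
  Σ0-extend n f m≤n f≈0 with ℕ.m≤n⇒m<n∨m≡n m≤n
  ... | inj₂ ≡.refl = refl
  Σ0-extend (suc n) f _ f≈0 | inj₁ (s≤s m≤n) =
    trans (+-cong (Σ0-extend n f m≤n (λ i m<i i≤n → f≈0 i m<i (ℕ.m≤n⇒m≤1+n i≤n))) (f≈0 (suc n) (s≤s m≤n) ℕ.≤-refl))
          (+-identityʳ _)

  Σ0-reverse : ∀ n (f : ℕ → Carrier) → Σ0 n f ≈ Σ0 n (λ i → f (n ∸ i))
  Σ0-reverse zero    f = refl
  Σ0-reverse (suc n) f = begin
    Σ0 n f + f (suc n)                        ≈⟨ +-congʳ (Σ0-reverse n f) ⟩
    Σ0 n (λ i → f (n ∸ i)) + f (suc n)        ≈⟨ +-comm _ _ ⟩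
    f (suc n) + Σ0 n (λ i → f (n ∸ i))        ≈⟨ Σ0-suc n (λ i → f (suc n ∸ i)) ⟨
    Σ0 (suc n) (λ i → f (suc n ∸ i))          ∎

  Σ0-triangle : ∀ n (h : ℕ → ℕ → Carrier) →
    Σ0 n (λ i → Σ0 i (λ j → h j (i ∸ j))) ≈ Σ0 n (λ j → Σ0 (n ∸ j) (h j))
  Σ0-triangle zero    h = refl
  Σ0-triangle (suc n) h = begin
    Σ0 n (λ i → Σ0 i (λ j → h j (i ∸ j))) + (Σ0 n (λ j → h j (suc n ∸ j)) + h (suc n) (suc n ∸ suc n))
      ≈⟨ +-congʳ (Σ0-triangle n h) ⟩
    Σ0 n (λ j → Σ0 (n ∸ j) (h j)) + (Σ0 n (λ j → h j (suc n ∸ j)) + h (suc n) (n ∸ n))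
      ≈⟨ +-assoc _ _ _ ⟨
    (Σ0 n (λ j → Σ0 (n ∸ j) (h j)) + Σ0 n (λ j → h j (suc n ∸ j))) + h (suc n) (n ∸ n)
      ≈⟨ +-cong (Σ0-distrib-+ n _ _) (reflexive (≡.cong (h (suc n)) (≡.sym (ℕ.n∸n≡0 n)))) ⟨
    Σ0 n (λ j → Σ0 (n ∸ j) (h j) + h j (suc n ∸ j)) + h (suc n) 0
      ≈⟨ +-cong (Σ0-cong n extend) (reflexive (≡.cong (λ k → Σ0 k (h (suc n))) (≡.sym (ℕ.n∸n≡0 n)))) ⟩
    Σ0 (suc n) (λ j → Σ0 (suc n ∸ j) (h j)) ∎
    where
    extend : ∀ j → j ≤ n → Σ0 (n ∸ j) (h j) + h j (suc n ∸ j) ≈ Σ0 (suc n ∸ j) (h j)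
    extend j j≤n rewrite ℕ.+-∸-assoc 1 j≤n = refl

  Σ1-suc : ∀ n (f : ℕ → Carrier) → Σ1 (suc n) f ≈ Σ0 n (λ i → f (suc i))
  Σ1-suc zero    f = +-identityˡ _
  Σ1-suc (suc n) f = +-congʳ (Σ1-suc n f)

  Π1-zero : ∀ n (f : ℕ → Carrier) {i} → 1 ≤ i → i ≤ n → f i ≈ 0# → Π1 n f ≈ 0#
  Π1-zero zero    f (s≤s _) ()
  Π1-zero (suc n) f {i} 1≤i i≤1+n fi≈0 with i ℕ.≟ suc n
  ... | yes ≡.refl = trans (*-congˡ fi≈0) (zeroʳ _)
  ... | no  i≢1+n  = trans (*-congʳ (Π1-zero n f 1≤i (ℕ.≤-pred (ℕ.≤∧≢⇒< i≤1+n i≢1+n)) fi≈0)) (zeroˡ _)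

  ι-+ : ∀ m n → ι (m ℕ.+ n) ≈ ι m + ι n
  ι-+ zero    n = sym (+-identityˡ _)
  ι-+ (suc m) n = trans (+-congˡ (ι-+ m n)) (sym (+-assoc _ _ _))

  ι-* : ∀ m n → ι (m ℕ.* n) ≈ ι m * ι n
  ι-* zero    n = sym (zeroˡ _)
  ι-* (suc m) n = begin
    ι (n ℕ.+ m ℕ.* n)         ≈⟨ ι-+ n (m ℕ.* n) ⟩
    ι n + ι (m ℕ.* n)         ≈⟨ +-cong (sym (*-identityˡ _)) (ι-* m n) ⟩
    1# * ι n + ι m * ι n      ≈⟨ distribʳ _ _ _ ⟨
    (1# + ι m) * ι n          ∎

  ^-congˡ : ∀ n {x y} → x ≈ y → x ^ n ≈ y ^ n
  ^-congˡ zero    x≈y = refl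
  ^-congˡ (suc n) x≈y = *-cong x≈y (^-congˡ n x≈y)

  ^-homo-* : ∀ x m n → x ^ (m ℕ.+ n) ≈ x ^ m * x ^ n
  ^-homo-* x zero    n = sym (*-identityˡ _)
  ^-homo-* x (suc m) n = trans (*-congˡ (^-homo-* x m n)) (sym (*-assoc _ _ _))

  ^-distrib-* : ∀ x y n → (x * y) ^ n ≈ x ^ n * y ^ n
  ^-distrib-* x y zero    = sym (*-identityˡ _)
  ^-distrib-* x y (suc n) = trans (*-congˡ (^-distrib-* x y n)) (*-interchange _ _ _ _)

  1^n≈1 : ∀ n → 1# ^ n ≈ 1#
  1^n≈1 zero    = refl
  1^n≈1 (suc n) = trans (*-identityˡ _) (1^n≈1 n)

  [-1]^n*[-1]^n≈1 : ∀ n → (- 1#) ^ n * (- 1#) ^ n ≈ 1#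
  [-1]^n*[-1]^n≈1 n = begin
    (- 1#) ^ n * (- 1#) ^ n    ≈⟨ ^-distrib-* (- 1#) (- 1#) n ⟨
    (- 1# * - 1#) ^ n          ≈⟨ ^-congˡ n (trans (-1*x≈-x _) (-‿involutive 1#)) ⟩
    1# ^ n                     ≈⟨ 1^n≈1 n ⟩
    1#                         ∎

  [-1]^n*[-1]^m≈[-1]^[n∸m] : ∀ {m n} → m ≤ n → (- 1#) ^ n * (- 1#) ^ m ≈ (- 1#) ^ (n ∸ m)
  [-1]^n*[-1]^m≈[-1]^[n∸m] {m} {n} m≤n = begin
    (- 1#) ^ n * (- 1#) ^ m                       ≡⟨ ≡.cong (λ k → (- 1#) ^ k * (- 1#) ^ m) (ℕ.m∸n+n≡m m≤n) ⟨
    (- 1#) ^ (n ∸ m ℕ.+ m) * (- 1#) ^ m           ≈⟨ *-congʳ (^-homo-* (- 1#) (n ∸ m) m) ⟩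
    (- 1#) ^ (n ∸ m) * (- 1#) ^ m * (- 1#) ^ m    ≈⟨ *-assoc _ _ _ ⟩
    (- 1#) ^ (n ∸ m) * ((- 1#) ^ m * (- 1#) ^ m)  ≈⟨ *-congˡ ([-1]^n*[-1]^n≈1 m) ⟩
    (- 1#) ^ (n ∸ m) * 1#                         ≈⟨ *-identityʳ _ ⟩
    (- 1#) ^ (n ∸ m)                              ∎

  *-^-∸-suc : ∀ a x m k → (m ≤ k → a ≈ 0#) → a * (x * x ^ (m ∸ suc k)) ≈ a * x ^ (m ∸ k)
  *-^-∸-suc a x m k a≈0 with ℕ.≤-<-connex m k
  ... | inj₁ m≤k = trans (*-congʳ (a≈0 m≤k)) (trans (zeroˡ _) (sym (trans (*-congʳ (a≈0 m≤k)) (zeroˡ _))))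
  ... | inj₂ k<m = *-congˡ (reflexive (≡.cong (x ^_) (≡.sym (ℕ.+-∸-assoc 1 k<m))))

  Σ0-support : ∀ m n (f : ℕ → Carrier) → (∀ i → m < i → i ≤ n → f i ≈ 0#) → (∀ i → n < i → i ≤ m → f i ≈ 0#) → Σ0 m f ≈ Σ0 n f
  Σ0-support m n f beyond-m beyond-n with ℕ.≤-total m n
  ... | inj₁ m≤n = sym (Σ0-extend n f m≤n beyond-m)
  ... | inj₂ n≤m = Σ0-extend m f n≤m beyond-n

[1+k]*[1+n]C[1+k]≡[1+n]*nCk : ∀ n k → suc k ℕ.* (suc n C suc k) ≡.≡ suc n ℕ.* (n C k)
[1+k]*[1+n]C[1+k]≡[1+n]*nCk zero    zero    = ≡.refl
[1+k]*[1+n]C[1+k]≡[1+n]*nCk zero    (suc k) = ℕ.*-zeroʳ (suc (suc k))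
[1+k]*[1+n]C[1+k]≡[1+n]*nCk (suc n) zero    = ≡.trans (ℕ.*-identityˡ _) (≡.trans (nC1≡n (suc (suc n))) (≡.sym (ℕ.*-identityʳ _)))
[1+k]*[1+n]C[1+k]≡[1+n]*nCk (suc n) (suc k) = begin
  suc (suc k) ℕ.* (suc (suc n) C suc (suc k))      ≡⟨ ≡.cong (suc (suc k) ℕ.*_) (nCk+nC[k+1]≡[n+1]C[k+1] (suc n) (suc k)) ⟨
  suc (suc k) ℕ.* (a ℕ.+ b)                        ≡⟨ ℕ.*-distribˡ-+ (suc (suc k)) a b ⟩
  (a ℕ.+ suc k ℕ.* a) ℕ.+ suc (suc k) ℕ.* b
    ≡⟨ ≡.cong₂ (λ x y → (a ℕ.+ x) ℕ.+ y) ([1+k]*[1+n]C[1+k]≡[1+n]*nCk n k) ([1+k]*[1+n]C[1+k]≡[1+n]*nCk n (suc k)) ⟩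
  (a ℕ.+ suc n ℕ.* (n C k)) ℕ.+ suc n ℕ.* (n C suc k)   ≡⟨ ℕ.+-assoc a _ _ ⟩
  a ℕ.+ (suc n ℕ.* (n C k) ℕ.+ suc n ℕ.* (n C suc k))   ≡⟨ ≡.cong (a ℕ.+_) (ℕ.*-distribˡ-+ (suc n) (n C k) (n C suc k)) ⟨
  a ℕ.+ suc n ℕ.* (n C k ℕ.+ n C suc k)                 ≡⟨ ≡.cong (λ x → a ℕ.+ suc n ℕ.* x) (nCk+nC[k+1]≡[n+1]C[k+1] n k) ⟩
  a ℕ.+ suc n ℕ.* a                                     ∎
  where
  open ≡.≡-Reasoning
  a = suc n C suc k
  b = suc n C suc (suc k)

[1+n∸k]*[1+n]Ck≡[1+n]*nCk : ∀ n k → (suc n ∸ k) ℕ.* (suc n C k) ≡.≡ suc n ℕ.* (n C k)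
[1+n∸k]*[1+n]Ck≡[1+n]*nCk n zero = ≡.refl
[1+n∸k]*[1+n]Ck≡[1+n]*nCk n (suc k) with ℕ.≤-<-connex n k
... | inj₁ n≤k = begin
  (n ∸ k) ℕ.* (suc n C suc k)   ≡⟨ ≡.cong (ℕ._* (suc n C suc k)) (ℕ.m≤n⇒m∸n≡0 n≤k) ⟩
  0                             ≡⟨ ℕ.*-zeroʳ (suc n) ⟨
  suc n ℕ.* 0                   ≡⟨ ≡.cong (suc n ℕ.*_) (k>n⇒nCk≡0 (s≤s n≤k)) ⟨
  suc n ℕ.* (n C suc k)         ∎
  where open ≡.≡-Reasoning
... | inj₂ k<n = ℕ.+-cancelʳ-≡ (suc k ℕ.* c) _ _ (begin
  (n ∸ k) ℕ.* c ℕ.+ suc k ℕ.* c                       ≡⟨ ℕ.*-distribʳ-+ c (n ∸ k) (suc k) ⟨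
  (n ∸ k ℕ.+ suc k) ℕ.* c                             ≡⟨ ≡.cong (ℕ._* c) (≡.trans (ℕ.+-suc (n ∸ k) k) (≡.cong suc (ℕ.m∸n+n≡m (ℕ.<⇒≤ k<n)))) ⟩
  suc n ℕ.* c                                         ≡⟨ ≡.cong (suc n ℕ.*_) (nCk+nC[k+1]≡[n+1]C[k+1] n k) ⟨
  suc n ℕ.* (n C k ℕ.+ n C suc k)                     ≡⟨ ℕ.*-distribˡ-+ (suc n) (n C k) (n C suc k) ⟩
  suc n ℕ.* (n C k) ℕ.+ suc n ℕ.* (n C suc k)         ≡⟨ ℕ.+-comm (suc n ℕ.* (n C k)) _ ⟩
  suc n ℕ.* (n C suc k) ℕ.+ suc n ℕ.* (n C k)         ≡⟨ ≡.cong (suc n ℕ.* (n C suc k) ℕ.+_) ([1+k]*[1+n]C[1+k]≡[1+n]*nCk n k) ⟨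
  suc n ℕ.* (n C suc k) ℕ.+ suc k ℕ.* c               ∎)
  where
  open ≡.≡-Reasoning
  c = suc n C suc k

-- Broder's r-Stirling numbers of the second kind; rStirling 1 d j is the Stirling number S(d+1, j+1).
rStirling : ℕ → ℕ → ℕ → ℕ
rStirling r zero    zero    = 1
rStirling r zero    (suc j) = 0
rStirling r (suc d) zero    = r ℕ.* rStirling r d zero
rStirling r (suc d) (suc j) = (r ℕ.+ suc j) ℕ.* rStirling r d (suc j) ℕ.+ rStirling r d j

rStirling-vanishes : ∀ r {d j} → d < j → rStirling r d j ≡.≡ 0
rStirling-vanishes r {zero}  {suc j} _ = ≡.refl
rStirling-vanishes r {suc d} {suc j} (s≤s d<j)
  rewrite rStirling-vanishes r {d} {suc j} (ℕ.m<n⇒m<1+n d<j) | rStirling-vanishes r d<j = ≡.trans (ℕ.+-identityʳ _) (ℕ.*-zeroʳ (r ℕ.+ suc j))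

rStirling-zero : ∀ r d → rStirling r d 0 ≡.≡ r ℕ.^ d
rStirling-zero r zero    = ≡.refl
rStirling-zero r (suc d) = ≡.cong (r ℕ.*_) (rStirling-zero r d)

module RStirlingExplicit {c ℓ : Level} (A : CommutativeRing c ℓ) where
  open CommutativeRing A
  open RingOps A
  open RingOpsProperties A
  open IntegerCoefficientSolver A using (solve; _:=_; con; _:+_; _:*_; :-_; _:-_)
  open import Relation.Binary.Reasoning.Setoid setoid

  alternatingBinomialSum : ∀ n → Σ0 (suc n) (λ i → (- 1#) ^ i * ι (suc n C i)) ≈ 0#
  alternatingBinomialSum n = begin
    Σ0 (suc n) (λ i → (- 1#) ^ i * ι (suc n C i))
      ≈⟨ Σ0-suc n _ ⟩
    1# * ι 1 + Σ0 n (λ i → (- 1#) ^ suc i * ι (suc n C suc i))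
      ≈⟨ +-congˡ (Σ0-cong n (λ i _ → trans (*-congˡ pascal) (distribˡ _ _ _))) ⟩
    1# * ι 1 + Σ0 n (λ i → (- 1#) ^ suc i * ι (n C i) + (- 1#) ^ suc i * ι (n C suc i))
      ≈⟨ +-congˡ (trans (Σ0-distrib-+ n _ _) (+-cong shiftedSum upperSum)) ⟩
    1# * ι 1 + (- 1# * a + (a - 1#))
      ≈⟨ solve 1 (λ a → con (+ 1) :* (con (+ 1) :+ con (+ 0)) :+ ((:- con (+ 1)) :* a :+ (a :- con (+ 1))) := con (+ 0)) refl a ⟩
    0# ∎
    where
    a = Σ0 n (λ i → (- 1#) ^ i * ι (n C i))
    pascal : ∀ {i} → ι (suc n C suc i) ≈ ι (n C i) + ι (n C suc i)
    pascal {i} = trans (reflexive (≡.cong ι (≡.sym (nCk+nC[k+1]≡[n+1]C[k+1] n i)))) (ι-+ (n C i) _)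
    shiftedSum : Σ0 n (λ i → (- 1#) ^ suc i * ι (n C i)) ≈ - 1# * a
    shiftedSum = trans (Σ0-cong n (λ i _ → *-assoc _ _ _)) (sym (*-distribˡ-Σ0 n (- 1#) _))
    upperSum : Σ0 n (λ i → (- 1#) ^ suc i * ι (n C suc i)) ≈ a - 1#
    upperSum = begin
      Σ0 n (λ i → (- 1#) ^ suc i * ι (n C suc i))
        ≈⟨ solve 1 (λ b → b := (con (+ 1) :* (con (+ 1) :+ con (+ 0)) :+ b) :- con (+ 1)) refl _ ⟩
      (1# * ι 1 + Σ0 n (λ i → (- 1#) ^ suc i * ι (n C suc i))) - 1#
        ≈⟨ +-congʳ (Σ0-suc n _) ⟨
      Σ0 (suc n) (λ i → (- 1#) ^ i * ι (n C i)) - 1#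
        ≈⟨ +-congʳ (Σ0-extend (suc n) _ (ℕ.n≤1+n n) (λ i n<i _ → trans (*-congˡ (reflexive (≡.cong ι (k>n⇒nCk≡0 n<i)))) (zeroʳ _))) ⟩
      a - 1# ∎

  alternatingPowerSum : ℕ → ℕ → ℕ → Carrier
  alternatingPowerSum r d j = Σ0 j (λ i → (- 1#) ^ i * ι (j C i) * ι ((i ℕ.+ r) ℕ.^ d))

  alternatingPowerSum-suc : ∀ r d n →
    alternatingPowerSum r (suc d) (suc n) ≈ ι (r ℕ.+ suc n) * alternatingPowerSum r d (suc n) - ι (suc n) * alternatingPowerSum r d n
  alternatingPowerSum-suc r d n = begin
    Σ0 (suc n) (λ i → (- 1#) ^ i * ι (suc n C i) * ι ((i ℕ.+ r) ℕ.* (i ℕ.+ r) ℕ.^ d))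
      ≈⟨ Σ0-cong (suc n) (λ i i≤ → *-congˡ (trans (ι-* (i ℕ.+ r) _) (*-congʳ (ι-split i i≤)))) ⟩
    Σ0 (suc n) (λ i → (- 1#) ^ i * ι (suc n C i) * ((ι (r ℕ.+ suc n) - ι (suc n ∸ i)) * w i))
      ≈⟨ Σ0-cong (suc n) (λ i _ → solve 5 (λ s c a b x → s :* c :* ((a :- b) :* x) := a :* (s :* c :* x) :- s :* (b :* c) :* x) refl _ _ _ _ _) ⟩
    Σ0 (suc n) (λ i → ι (r ℕ.+ suc n) * ((- 1#) ^ i * ι (suc n C i) * w i) - (- 1#) ^ i * (ι (suc n ∸ i) * ι (suc n C i)) * w i)
      ≈⟨ Σ0-distrib-+ (suc n) _ _ ⟩
    Σ0 (suc n) (λ i → ι (r ℕ.+ suc n) * ((- 1#) ^ i * ι (suc n C i) * w i)) + Σ0 (suc n) (λ i → - ((- 1#) ^ i * (ι (suc n ∸ i) * ι (suc n C i)) * w i))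
      ≈⟨ +-cong (sym (*-distribˡ-Σ0 (suc n) _ _)) (trans (sym (-‿distrib-Σ0 (suc n) _)) (-‿cong lowerSum)) ⟩
    ι (r ℕ.+ suc n) * alternatingPowerSum r d (suc n) - ι (suc n) * alternatingPowerSum r d n ∎
    where
    w : ℕ → Carrier
    w i = ι ((i ℕ.+ r) ℕ.^ d)
    ι-split : ∀ i → i ≤ suc n → ι (i ℕ.+ r) ≈ ι (r ℕ.+ suc n) - ι (suc n ∸ i)
    ι-split i i≤ = begin
      ι (i ℕ.+ r)                                   ≈⟨ solve 2 (λ a b → a := (a :+ b) :- b) refl _ _ ⟩
      (ι (i ℕ.+ r) + ι (suc n ∸ i)) - ι (suc n ∸ i) ≈⟨ +-congʳ (ι-+ (i ℕ.+ r) _) ⟨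
      ι (i ℕ.+ r ℕ.+ (suc n ∸ i)) - ι (suc n ∸ i)   ≡⟨ ≡.cong (λ m → ι m - ι (suc n ∸ i)) sum≡ ⟩
      ι (r ℕ.+ suc n) - ι (suc n ∸ i)               ∎
      where
      sum≡ : i ℕ.+ r ℕ.+ (suc n ∸ i) ≡.≡ r ℕ.+ suc n
      sum≡ = ≡.trans (≡.cong (ℕ._+ (suc n ∸ i)) (ℕ.+-comm i r))
               (≡.trans (ℕ.+-assoc r i _) (≡.cong (r ℕ.+_) (ℕ.m+[n∸m]≡n i≤)))
    lowerSum : Σ0 (suc n) (λ i → (- 1#) ^ i * (ι (suc n ∸ i) * ι (suc n C i)) * w i) ≈ ι (suc n) * alternatingPowerSum r d n
    lowerSum = begin
      Σ0 (suc n) (λ i → (- 1#) ^ i * (ι (suc n ∸ i) * ι (suc n C i)) * w i)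
        ≈⟨ Σ0-cong (suc n) (λ i _ → *-congʳ (*-congˡ (trans (sym (ι-* (suc n ∸ i) _))
             (trans (reflexive (≡.cong ι ([1+n∸k]*[1+n]Ck≡[1+n]*nCk n i))) (ι-* (suc n) (n C i)))))) ⟩
      Σ0 (suc n) (λ i → (- 1#) ^ i * (ι (suc n) * ι (n C i)) * w i)
        ≈⟨ Σ0-cong (suc n) (λ i _ → solve 4 (λ s a c x → s :* (a :* c) :* x := a :* (s :* c :* x)) refl _ _ _ _) ⟩
      Σ0 (suc n) (λ i → ι (suc n) * ((- 1#) ^ i * ι (n C i) * w i))
        ≈⟨ *-distribˡ-Σ0 (suc n) _ _ ⟨
      ι (suc n) * Σ0 (suc n) (λ i → (- 1#) ^ i * ι (n C i) * w i)
        ≈⟨ *-congˡ (Σ0-extend (suc n) _ (ℕ.n≤1+n n)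
             (λ i n<i _ → trans (*-congʳ (trans (*-congˡ (reflexive (≡.cong ι (k>n⇒nCk≡0 n<i)))) (zeroʳ _))) (zeroˡ _))) ⟩
      ι (suc n) * alternatingPowerSum r d n ∎

  rStirling-explicit : ∀ r d j → alternatingPowerSum r d j ≈ (- 1#) ^ j * ι (j !) * ι (rStirling r d j)
  rStirling-explicit r d zero = reflexive (≡.cong (λ m → 1# * ι 1 * ι m) (≡.sym (rStirling-zero r d)))
  rStirling-explicit r zero (suc n) = begin
    Σ0 (suc n) (λ i → (- 1#) ^ i * ι (suc n C i) * ι 1)   ≈⟨ Σ0-cong (suc n) (λ i _ → trans (*-congˡ (+-identityʳ 1#)) (*-identityʳ _)) ⟩
    Σ0 (suc n) (λ i → (- 1#) ^ i * ι (suc n C i))         ≈⟨ alternatingBinomialSum n ⟩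
    0#                                                   ≈⟨ zeroʳ _ ⟨
    (- 1#) ^ suc n * ι (suc n !) * 0#                     ∎
  rStirling-explicit r (suc d) (suc n) = begin
    alternatingPowerSum r (suc d) (suc n)
      ≈⟨ alternatingPowerSum-suc r d n ⟩
    a * alternatingPowerSum r d (suc n) - b * alternatingPowerSum r d n
      ≈⟨ +-cong (*-congˡ (rStirling-explicit r d (suc n))) (-‿cong (*-congˡ (rStirling-explicit r d n))) ⟩
    a * ((- 1# * s) * ι (suc n !) * S₁) - b * (s * f * S₀)
      ≈⟨ +-congʳ (*-congˡ (*-congʳ (*-congˡ (ι-* (suc n) (n !))))) ⟩
    a * ((- 1# * s) * (b * f) * S₁) - b * (s * f * S₀)
      ≈⟨ solve 6 (λ a b s f S₁ S₀ → a :* (((:- con (+ 1)) :* s) :* (b :* f) :* S₁) :- b :* (s :* f :* S₀)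
                                    := ((:- con (+ 1)) :* s) :* (b :* f) :* (a :* S₁ :+ S₀)) refl a b s f S₁ S₀ ⟩
    (- 1# * s) * (b * f) * (a * S₁ + S₀)
      ≈⟨ *-cong (*-congˡ (sym (ι-* (suc n) (n !)))) (sym (trans (ι-+ ((r ℕ.+ suc n) ℕ.* rStirling r d (suc n)) _) (+-congʳ (ι-* (r ℕ.+ suc n) _)))) ⟩
    (- 1#) ^ suc n * ι (suc n !) * ι (rStirling r (suc d) (suc n)) ∎
    where
    a = ι (r ℕ.+ suc n)
    b = ι (suc n)
    s = (- 1#) ^ n
    f = ι (n !)
    S₁ = ι (rStirling r d (suc n))
    S₀ = ι (rStirling r d n)

  rStirling-explicit-reversed : ∀ r d j → Σ0 j (λ i → (- 1#) ^ i * ι (j C i) * ι ((j ℕ.+ r ∸ i) ℕ.^ d)) ≈ ι (j !) * ι (rStirling r d j)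
  rStirling-explicit-reversed r d j = begin
    Σ0 j (λ i → (- 1#) ^ i * ι (j C i) * ι ((j ℕ.+ r ∸ i) ℕ.^ d))
      ≈⟨ Σ0-reverse j _ ⟩
    Σ0 j (λ i → (- 1#) ^ (j ∸ i) * ι (j C (j ∸ i)) * ι ((j ℕ.+ r ∸ (j ∸ i)) ℕ.^ d))
      ≈⟨ Σ0-cong j (λ i i≤j → trans (*-cong (*-cong (sym ([-1]^n*[-1]^m≈[-1]^[n∸m] i≤j)) (reflexive (≡.cong ι (≡.sym (nCk≡nC[n∸k] i≤j)))))
                                              (reflexive (≡.cong (λ m → ι (m ℕ.^ d)) (index i≤j))))
                                      (solve 4 (λ s t c w → s :* t :* c :* w := s :* (t :* c :* w)) refl _ _ _ _)) ⟩
    Σ0 j (λ i → (- 1#) ^ j * ((- 1#) ^ i * ι (j C i) * ι ((i ℕ.+ r) ℕ.^ d)))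
      ≈⟨ *-distribˡ-Σ0 j _ _ ⟨
    (- 1#) ^ j * alternatingPowerSum r d j
      ≈⟨ *-congˡ (rStirling-explicit r d j) ⟩
    (- 1#) ^ j * ((- 1#) ^ j * ι (j !) * ι (rStirling r d j))
      ≈⟨ solve 3 (λ s f S → s :* (s :* f :* S) := (s :* s) :* (f :* S)) refl _ _ _ ⟩
    ((- 1#) ^ j * (- 1#) ^ j) * (ι (j !) * ι (rStirling r d j))
      ≈⟨ trans (*-congʳ ([-1]^n*[-1]^n≈1 j)) (*-identityˡ _) ⟩
    ι (j !) * ι (rStirling r d j) ∎
    where
    index : ∀ {i} → i ≤ j → j ℕ.+ r ∸ (j ∸ i) ≡.≡ i ℕ.+ r
    index {i} i≤j = ≡.trans (ℕ.+-∸-comm r (ℕ.m∸n≤m j i)) (≡.cong (ℕ._+ r) (ℕ.m∸[m∸n]≡n i≤j))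

iterate-suc : ∀ {a} {X : Set a} (f : X → X) x n → iterate f x (suc n) ≡.≡ f (iterate f x n)
iterate-suc f x n = ≡.trans (≡.sym (iterate-is-fold x f (suc n))) (≡.cong f (iterate-is-fold x f n))

record IsDerivation {c ℓ : Level} (A : CommutativeRing c ℓ) (δ : CommutativeRing.Carrier A → CommutativeRing.Carrier A) : Set (c ⊔ ℓ) where
  open CommutativeRing A
  field
    cong    : ∀ {f g} → f ≈ g → δ f ≈ δ g
    +-homo  : ∀ f g → δ (f + g) ≈ δ f + δ g
    leibniz : ∀ f g → δ (f * g) ≈ δ f * g + f * δ g

module DerivationProperties {c ℓ : Level} (A : CommutativeRing c ℓ) {δ : CommutativeRing.Carrier A → CommutativeRing.Carrier A}
                            (isDerivation : IsDerivation A δ) where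
  open CommutativeRing A
  open RingOps A
  open IsDerivation isDerivation
  open RingOpsProperties A
  open IntegerCoefficientSolver A using (solve; _:=_; con; _:+_; _:*_)
  open import Algebra.Properties.Ring ring using (x+x≈x⇒x≈0; +-inverseˡ-unique)
  open import Relation.Binary.Reasoning.Setoid setoid

  δ-0 : δ 0# ≈ 0#
  δ-0 = x+x≈x⇒x≈0 (δ 0#) (trans (sym (+-homo 0# 0#)) (cong (+-identityʳ 0#)))

  δ-1 : δ 1# ≈ 0#
  δ-1 = x+x≈x⇒x≈0 (δ 1#) (sym (begin
    δ 1#                    ≈⟨ cong (*-identityʳ 1#) ⟨
    δ (1# * 1#)             ≈⟨ leibniz 1# 1# ⟩
    δ 1# * 1# + 1# * δ 1#   ≈⟨ +-cong (*-identityʳ _) (*-identityˡ _) ⟩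
    δ 1# + δ 1#             ∎))

  δ-‿ : ∀ f → δ (- f) ≈ - δ f
  δ-‿ f = +-inverseˡ-unique (δ (- f)) (δ f) (trans (sym (+-homo (- f) f)) (trans (cong (-‿inverseˡ f)) δ-0))

  δ-ι : ∀ n → δ (ι n) ≈ 0#
  δ-ι zero    = δ-0
  δ-ι (suc n) = trans (+-homo 1# (ι n)) (trans (+-cong δ-1 (δ-ι n)) (+-identityʳ 0#))

  δ-Σ0 : ∀ n (h : ℕ → Carrier) → δ (Σ0 n h) ≈ Σ0 n (λ j → δ (h j))
  δ-Σ0 zero    h = refl
  δ-Σ0 (suc n) h = trans (+-homo _ _) (+-congʳ (δ-Σ0 n h))

  δ-^ : ∀ f n → δ (f ^ suc n) ≈ ι (suc n) * f ^ n * δ f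
  δ-^ f zero = begin
    δ (f * 1#)                 ≈⟨ leibniz f 1# ⟩
    δ f * 1# + f * δ 1#        ≈⟨ +-congˡ (*-congˡ δ-1) ⟩
    δ f * 1# + f * 0#          ≈⟨ solve 2 (λ d f → d :* con (+ 1) :+ f :* con (+ 0) := (con (+ 1) :+ con (+ 0)) :* con (+ 1) :* d) refl (δ f) f ⟩
    ι 1 * 1# * δ f             ∎
  δ-^ f (suc n) = begin
    δ (f * f ^ suc n)                              ≈⟨ leibniz f (f ^ suc n) ⟩
    δ f * f ^ suc n + f * δ (f ^ suc n)            ≈⟨ +-congˡ (*-congˡ (δ-^ f n)) ⟩
    δ f * (f * f ^ n) + f * (ι (suc n) * f ^ n * δ f)
      ≈⟨ solve 4 (λ d f p k → d :* (f :* p) :+ f :* (k :* p :* d) := (con (+ 1) :+ k) :* (f :* p) :* d) refl (δ f) f (f ^ n) (ι (suc n)) ⟩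
    ι (suc (suc n)) * f ^ suc n * δ f              ∎

  δ-*-constantˡ : ∀ {a} f → δ a ≈ 0# → δ (a * f) ≈ a * δ f
  δ-*-constantˡ {a} f δa≈0 = trans (leibniz a f) (trans (+-congʳ (trans (*-congʳ δa≈0) (zeroˡ f))) (+-identityˡ _))

  δ-^-constant : ∀ {a} n → δ a ≈ 0# → δ (a ^ n) ≈ 0#
  δ-^-constant zero    δa≈0 = δ-1
  δ-^-constant {a} (suc n) δa≈0 = trans (δ-*-constantˡ (a ^ n) δa≈0) (trans (*-congˡ (δ-^-constant n δa≈0)) (zeroʳ a))

  scaled-isDerivation : ∀ a → IsDerivation A (λ f → a * δ f)
  scaled-isDerivation a = record
    { cong    = λ f≈g → *-congˡ (cong f≈g)
    ; +-homo  = λ f g → trans (*-congˡ (+-homo f g)) (distribˡ a _ _)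
    ; leibniz = λ f g → trans (*-congˡ (leibniz f g))
        (solve 5 (λ a x g f y → a :* (x :* g :+ f :* y) := a :* x :* g :+ f :* (a :* y)) refl a (δ f) g f (δ g))
    }

  iterate-cong : ∀ {f g} n → f ≈ g → iterate δ f n ≈ iterate δ g n
  iterate-cong zero    f≈g = f≈g
  iterate-cong (suc n) f≈g = iterate-cong n (cong f≈g)

  module RaisingExpansion (r : ℕ) (κ : Carrier) (δκ≈0 : δ κ ≈ 0#) (s : ℕ → Carrier)
                          (δs : ∀ j → δ (s j) ≈ ι (r ℕ.+ j) * κ * s j + s (suc j)) where

    coefficient : ℕ → ℕ → Carrier
    coefficient d j = ι (rStirling r d j) * κ ^ (d ∸ j)

    δ-coefficient : ∀ d j → δ (coefficient d j) ≈ 0#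
    δ-coefficient d j = trans (δ-*-constantˡ _ (δ-ι (rStirling r d j))) (trans (*-congˡ (δ-^-constant (d ∸ j) δκ≈0)) (zeroʳ _))

    expansion-step : ∀ d → Σ0 d (λ j → coefficient d j * δ (s j)) ≈ Σ0 (suc d) (λ j → coefficient (suc d) j * s j)
    expansion-step d = begin
      Σ0 d (λ j → coefficient d j * δ (s j))
        ≈⟨ Σ0-cong d (λ j _ → trans (*-congˡ (δs j)) (distribˡ _ _ _)) ⟩
      Σ0 d (λ j → coefficient d j * (ι (r ℕ.+ j) * κ * s j) + coefficient d j * s (suc j))
        ≈⟨ Σ0-distrib-+ d _ _ ⟩
      Σ0 d raised + Σ0 d (λ j → coefficient d j * s (suc j))
        ≈⟨ +-congʳ (Σ0-extend (suc d) raised (ℕ.n≤1+n d) raised-vanishes) ⟨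
      Σ0 (suc d) raised + Σ0 d (λ j → coefficient d j * s (suc j))
        ≈⟨ +-congʳ (Σ0-suc d raised) ⟩
      (raised 0 + Σ0 d (λ j → raised (suc j))) + Σ0 d (λ j → coefficient d j * s (suc j))
        ≈⟨ +-assoc _ _ _ ⟩
      raised 0 + (Σ0 d (λ j → raised (suc j)) + Σ0 d (λ j → coefficient d j * s (suc j)))
        ≈⟨ +-cong first-term (trans (Σ0-cong d (λ j _ → sym (later-term j))) (Σ0-distrib-+ d _ _)) ⟨
      coefficient (suc d) 0 * s 0 + Σ0 d (λ j → coefficient (suc d) (suc j) * s (suc j))
        ≈⟨ Σ0-suc d _ ⟨
      Σ0 (suc d) (λ j → coefficient (suc d) j * s j) ∎
      where
      raised : ℕ → Carrier
      raised j = coefficient d j * (ι (r ℕ.+ j) * κ * s j)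
      raised-vanishes : ∀ j → d < j → j ≤ suc d → raised j ≈ 0#
      raised-vanishes j d<j _ = trans (*-congʳ (trans (*-congʳ (reflexive (≡.cong ι (rStirling-vanishes r d<j)))) (zeroˡ _))) (zeroˡ _)
      first-term : coefficient (suc d) 0 * s 0 ≈ raised 0
      first-term = begin
        ι (r ℕ.* rStirling r d 0) * (κ * κ ^ d) * s 0
          ≈⟨ *-congʳ (*-congʳ (ι-* r _)) ⟩
        ι r * ι (rStirling r d 0) * (κ * κ ^ d) * s 0
          ≡⟨ ≡.cong (λ m → ι m * ι (rStirling r d 0) * (κ * κ ^ d) * s 0) (≡.sym (ℕ.+-identityʳ r)) ⟩
        ι (r ℕ.+ 0) * ι (rStirling r d 0) * (κ * κ ^ d) * s 0
          ≈⟨ solve 5 (λ a b k p x → a :* b :* (k :* p) :* x := b :* p :* (a :* k :* x)) refl _ _ _ _ _ ⟩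
        raised 0 ∎
      later-term : ∀ j → raised (suc j) + coefficient d j * s (suc j) ≈ coefficient (suc d) (suc j) * s (suc j)
      later-term j = begin
        ι S₁ * κ ^ (d ∸ suc j) * (ι (r ℕ.+ suc j) * κ * s (suc j)) + coefficient d j * s (suc j)
          ≈⟨ +-congʳ (solve 5 (λ a p b k x → a :* p :* (b :* k :* x) := b :* (a :* (k :* p)) :* x) refl _ _ _ _ _) ⟩
        ι (r ℕ.+ suc j) * (ι S₁ * (κ * κ ^ (d ∸ suc j))) * s (suc j) + coefficient d j * s (suc j)
          ≈⟨ +-congʳ (*-congʳ (*-congˡ (*-^-∸-suc (ι S₁) κ d j (λ d≤j → reflexive (≡.cong ι (rStirling-vanishes r (s≤s d≤j))))))) ⟩
        ι (r ℕ.+ suc j) * (ι S₁ * κ ^ (d ∸ j)) * s (suc j) + ι S₀ * κ ^ (d ∸ j) * s (suc j)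
          ≈⟨ solve 5 (λ a b c p x → a :* (b :* p) :* x :+ c :* p :* x := (a :* b :+ c) :* p :* x) refl _ _ _ _ _ ⟩
        (ι (r ℕ.+ suc j) * ι S₁ + ι S₀) * κ ^ (d ∸ j) * s (suc j)
          ≈⟨ *-congʳ (*-congʳ (trans (ι-+ ((r ℕ.+ suc j) ℕ.* S₁) S₀) (+-congʳ (ι-* (r ℕ.+ suc j) S₁)))) ⟨
        coefficient (suc d) (suc j) * s (suc j) ∎
        where
        S₁ = rStirling r d (suc j)
        S₀ = rStirling r d j

    expansion : ∀ d → iterate δ (s 0) d ≈ Σ0 d (λ j → coefficient d j * s j)
    expansion zero = solve 1 (λ x → x := (con (+ 1) :+ con (+ 0)) :* con (+ 1) :* x) refl (s 0)
    expansion (suc d) = begin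
      iterate δ (s 0) (suc d)                         ≡⟨ iterate-suc δ (s 0) d ⟩
      δ (iterate δ (s 0) d)                           ≈⟨ cong (expansion d) ⟩
      δ (Σ0 d (λ j → coefficient d j * s j))          ≈⟨ δ-Σ0 d _ ⟩
      Σ0 d (λ j → δ (coefficient d j * s j))          ≈⟨ Σ0-cong d (λ j _ → δ-*-constantˡ (s j) (δ-coefficient d j)) ⟩
      Σ0 d (λ j → coefficient d j * δ (s j))          ≈⟨ expansion-step d ⟩
      Σ0 (suc d) (λ j → coefficient (suc d) j * s j)  ∎

module PowerSeries {c ℓ : Level} (R : CommutativeRing c ℓ) where
  open CommutativeRing R
  open RingOps R
  open RingOpsProperties R
  open IntegerCoefficientSolver R using (solve; _:=_; _:*_)
  open import Relation.Binary.Reasoning.Setoid setoid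
  import Algebra.Construct.Pointwise ℕ as Pointwise

  Series : Set c
  Series = ℕ → Carrier

  infix 4 _≈ₛ_
  infixl 6 _+ₛ_
  infixl 7 _*ₛ_

  _≈ₛ_ : Series → Series → Set ℓ
  f ≈ₛ g = ∀ n → f n ≈ g n

  _+ₛ_ : Series → Series → Series
  (f +ₛ g) n = f n + g n

  -ₛ_ : Series → Series
  (-ₛ f) n = - f n

  0ₛ : Series
  0ₛ _ = 0#

  constant : Carrier → Series
  constant a zero    = a
  constant a (suc n) = 0#

  X : Series
  X zero          = 0#
  X (suc zero)    = 1#
  X (suc (suc n)) = 0#

  -- Opaque, so that unification does not unfold products and derivatives under the pointwise equality.
  opaque
    _*ₛ_ : Series → Series → Series
    (f *ₛ g) n = Σ0 n (λ i → f i * g (n ∸ i))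

    D : Series → Series
    D f n = ι (suc n) * f (suc n)

  opaque
    unfolding _*ₛ_ D

    D-apply : ∀ f n → D f n ≡.≡ ι (suc n) * f (suc n)
    D-apply f n = ≡.refl

    D-constant : ∀ a → D (constant a) ≈ₛ 0ₛ
    D-constant a n = zeroʳ _

    D-X : D X ≈ₛ constant 1#
    D-X zero    = trans (*-identityʳ _) (+-identityʳ 1#)
    D-X (suc n) = zeroʳ _

    D-cong : ∀ {f g} → f ≈ₛ g → D f ≈ₛ D g
    D-cong f≈g n = *-congˡ (f≈g (suc n))

    D-+ : ∀ f g → D (f +ₛ g) ≈ₛ D f +ₛ D g
    D-+ f g n = distribˡ _ _ _

    *ₛ-cong : ∀ {f f′ g g′} → f ≈ₛ f′ → g ≈ₛ g′ → f *ₛ g ≈ₛ f′ *ₛ g′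
    *ₛ-cong f≈f′ g≈g′ n = Σ0-cong n (λ i _ → *-cong (f≈f′ i) (g≈g′ (n ∸ i)))

    *ₛ-comm : ∀ f g → f *ₛ g ≈ₛ g *ₛ f
    *ₛ-comm f g n = begin
      Σ0 n (λ i → f i * g (n ∸ i))                  ≈⟨ Σ0-reverse n _ ⟩
      Σ0 n (λ i → f (n ∸ i) * g (n ∸ (n ∸ i)))      ≈⟨ Σ0-cong n (λ i i≤n → trans (*-comm _ _) (*-congʳ (reflexive (≡.cong g (ℕ.m∸[m∸n]≡n i≤n))))) ⟩
      Σ0 n (λ i → g i * f (n ∸ i))                  ∎

    *ₛ-assoc : ∀ f g h → (f *ₛ g) *ₛ h ≈ₛ f *ₛ (g *ₛ h)
    *ₛ-assoc f g h n = begin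
      Σ0 n (λ i → Σ0 i (λ j → f j * g (i ∸ j)) * h (n ∸ i))
        ≈⟨ Σ0-cong n (λ i _ → trans (*-comm _ _) (*-distribˡ-Σ0 i _ _)) ⟩
      Σ0 n (λ i → Σ0 i (λ j → h (n ∸ i) * (f j * g (i ∸ j))))
        ≈⟨ Σ0-cong n (λ i i≤n → Σ0-cong i (λ j j≤i → *-congʳ (reflexive (≡.cong (λ m → h (n ∸ m)) (≡.sym (ℕ.m+[n∸m]≡n j≤i)))))) ⟩
      Σ0 n (λ i → Σ0 i (λ j → h (n ∸ (j ℕ.+ (i ∸ j))) * (f j * g (i ∸ j))))
        ≈⟨ Σ0-triangle n (λ j l → h (n ∸ (j ℕ.+ l)) * (f j * g l)) ⟩
      Σ0 n (λ j → Σ0 (n ∸ j) (λ l → h (n ∸ (j ℕ.+ l)) * (f j * g l)))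
        ≈⟨ Σ0-cong n (λ j _ → trans (Σ0-cong (n ∸ j) (λ l _ → reassociate j l)) (sym (*-distribˡ-Σ0 (n ∸ j) (f j) _))) ⟩
      Σ0 n (λ j → f j * Σ0 (n ∸ j) (λ l → g l * h (n ∸ j ∸ l))) ∎
      where
      reassociate : ∀ j l → h (n ∸ (j ℕ.+ l)) * (f j * g l) ≈ f j * (g l * h (n ∸ j ∸ l))
      reassociate j l = trans (reflexive (≡.cong (λ m → h m * (f j * g l)) (≡.sym (ℕ.∸-+-assoc n j l))))
                              (solve 3 (λ a b c → c :* (a :* b) := a :* (b :* c)) refl (f j) (g l) (h (n ∸ j ∸ l)))

    constant-*ₛ : ∀ a f → constant a *ₛ f ≈ₛ λ n → a * f n
    constant-*ₛ a f zero    = refl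
    constant-*ₛ a f (suc n) = begin
      Σ0 (suc n) (λ i → constant a i * f (suc n ∸ i))       ≈⟨ Σ0-suc n _ ⟩
      a * f (suc n) + Σ0 n (λ i → 0# * f (n ∸ i))           ≈⟨ +-congˡ (Σ0-zero n _ (λ i _ → zeroˡ _)) ⟩
      a * f (suc n) + 0#                                   ≈⟨ +-identityʳ _ ⟩
      a * f (suc n)                                        ∎

    *ₛ-distribˡ : ∀ f g h → f *ₛ (g +ₛ h) ≈ₛ f *ₛ g +ₛ f *ₛ h
    *ₛ-distribˡ f g h n = trans (Σ0-cong n (λ i _ → distribˡ _ _ _)) (Σ0-distrib-+ n _ _)

    X-*ₛ-zero : ∀ f → (X *ₛ f) 0 ≈ 0#
    X-*ₛ-zero f = zeroˡ _

    X-*ₛ-suc : ∀ f n → (X *ₛ f) (suc n) ≈ f n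
    X-*ₛ-suc f n = begin
      Σ0 (suc n) (λ i → X i * f (suc n ∸ i))              ≈⟨ Σ0-suc n _ ⟩
      0# * f (suc n) + Σ0 n (λ i → X (suc i) * f (n ∸ i)) ≈⟨ +-cong (zeroˡ _) (Σ0-cong n (λ i _ → *-congʳ (X-suc i))) ⟩
      0# + (constant 1# *ₛ f) n                          ≈⟨ trans (+-identityˡ _) (trans (constant-*ₛ 1# f n) (*-identityˡ _)) ⟩
      f n                                                ∎
      where
      X-suc : ∀ i → X (suc i) ≈ constant 1# i
      X-suc zero    = refl
      X-suc (suc i) = refl

    D-leibniz : ∀ f g → D (f *ₛ g) ≈ₛ D f *ₛ g +ₛ f *ₛ D g
    D-leibniz f g n = sym (begin
      Σ0 n (λ i → ι (suc i) * f (suc i) * g (n ∸ i)) + Σ0 n (λ i → f i * (ι (suc (n ∸ i)) * g (suc (n ∸ i))))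
        ≈⟨ +-cong derivativeOfLeft derivativeOfRight ⟩
      Σ0 (suc n) (λ i → ι i * (f i * g (suc n ∸ i))) + Σ0 (suc n) (λ i → ι (suc n ∸ i) * (f i * g (suc n ∸ i)))
        ≈⟨ Σ0-distrib-+ (suc n) _ _ ⟨
      Σ0 (suc n) (λ i → ι i * (f i * g (suc n ∸ i)) + ι (suc n ∸ i) * (f i * g (suc n ∸ i)))
        ≈⟨ Σ0-cong (suc n) (λ i i≤ → trans (sym (distribʳ _ _ _))
              (*-congʳ (trans (sym (ι-+ i _)) (reflexive (≡.cong ι (ℕ.m+[n∸m]≡n i≤)))))) ⟩
      Σ0 (suc n) (λ i → ι (suc n) * (f i * g (suc n ∸ i)))
        ≈⟨ *-distribˡ-Σ0 (suc n) _ _ ⟨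
      ι (suc n) * (f *ₛ g) (suc n) ∎)
      where
      derivativeOfLeft : Σ0 n (λ i → ι (suc i) * f (suc i) * g (n ∸ i)) ≈ Σ0 (suc n) (λ i → ι i * (f i * g (suc n ∸ i)))
      derivativeOfLeft = sym (begin
        Σ0 (suc n) (λ i → ι i * (f i * g (suc n ∸ i)))                   ≈⟨ Σ0-suc n _ ⟩
        0# * (f 0 * g (suc n)) + Σ0 n (λ i → ι (suc i) * (f (suc i) * g (n ∸ i)))
          ≈⟨ trans (+-congʳ (zeroˡ _)) (+-identityˡ _) ⟩
        Σ0 n (λ i → ι (suc i) * (f (suc i) * g (n ∸ i)))                   ≈⟨ Σ0-cong n (λ i _ → sym (*-assoc _ _ _)) ⟩
        Σ0 n (λ i → ι (suc i) * f (suc i) * g (n ∸ i))                     ∎)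
      derivativeOfRight : Σ0 n (λ i → f i * (ι (suc (n ∸ i)) * g (suc (n ∸ i)))) ≈ Σ0 (suc n) (λ i → ι (suc n ∸ i) * (f i * g (suc n ∸ i)))
      derivativeOfRight = sym (begin
        Σ0 n (λ i → ι (suc n ∸ i) * (f i * g (suc n ∸ i))) + ι (suc n ∸ suc n) * (f (suc n) * g (suc n ∸ suc n))
          ≈⟨ +-cong (Σ0-cong n (λ i i≤n → trans (reflexive (≡.cong (λ m → ι m * (f i * g m)) (ℕ.+-∸-assoc 1 i≤n)))
                        (solve 3 (λ a b c → a :* (b :* c) := b :* (a :* c)) refl _ _ _)))
                    (trans (*-congʳ (reflexive (≡.cong ι (ℕ.n∸n≡0 n)))) (zeroˡ _)) ⟩
        Σ0 n (λ i → f i * (ι (suc (n ∸ i)) * g (suc (n ∸ i)))) + 0#      ≈⟨ +-identityʳ _ ⟩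
        Σ0 n (λ i → f i * (ι (suc (n ∸ i)) * g (suc (n ∸ i))))           ∎)

    *ₛ-apply : ∀ f g n → (f *ₛ g) n ≡.≡ Σ0 n (λ i → f i * g (n ∸ i))
    *ₛ-apply f g n = ≡.refl

  *ₛ-identityˡ : ∀ f → constant 1# *ₛ f ≈ₛ f
  *ₛ-identityˡ f n = trans (constant-*ₛ 1# f n) (*-identityˡ _)

  seriesRing : CommutativeRing c ℓ
  seriesRing = record
    { Carrier = Series ; _≈_ = _≈ₛ_ ; _+_ = _+ₛ_ ; _*_ = _*ₛ_ ; -_ = -ₛ_ ; 0# = 0ₛ ; 1# = constant 1#
    ; isCommutativeRing = record
      { isRing = record
        { +-isAbelianGroup = Pointwise.isAbelianGroup +-isAbelianGroup
        ; *-cong = *ₛ-cong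
        ; *-assoc = *ₛ-assoc
        ; *-identity = *ₛ-identityˡ , λ f n → trans (*ₛ-comm f (constant 1#) n) (*ₛ-identityˡ f n)
        ; distrib = *ₛ-distribˡ , λ h f g n → trans (*ₛ-comm (f +ₛ g) h n)
                                   (trans (*ₛ-distribˡ h f g n) (+-cong (*ₛ-comm h f n) (*ₛ-comm h g n)))
        }
      ; *-comm = *ₛ-comm
      }
    }

  open RingOps seriesRing public using () renaming (ι to ιₛ; _^_ to _^ₛ_; Σ0 to Σ0ₛ)
  open RingOpsProperties seriesRing using () renaming (^-congˡ to ^ₛ-congˡ; ^-distrib-* to ^ₛ-distrib-*ₛ)
  open import Algebra.Properties.Ring ring using (-0#≈0#)

  D-isDerivation : IsDerivation seriesRing D
  D-isDerivation = record
    { cong    = D-cong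
    ; +-homo  = D-+
    ; leibniz = D-leibniz
    }

  Σ0ₛ-apply : ∀ n (h : ℕ → Series) m → Σ0ₛ n h m ≈ Σ0 n (λ j → h j m)
  Σ0ₛ-apply zero    h m = refl
  Σ0ₛ-apply (suc n) h m = +-congʳ (Σ0ₛ-apply n h m)

  constant-+ : ∀ a b → constant (a + b) ≈ₛ constant a +ₛ constant b
  constant-+ a b zero    = refl
  constant-+ a b (suc n) = sym (+-identityˡ 0#)

  constant-* : ∀ a b → constant (a * b) ≈ₛ constant a *ₛ constant b
  constant-* a b zero    = sym (constant-*ₛ a (constant b) 0)
  constant-* a b (suc n) = sym (trans (constant-*ₛ a (constant b) (suc n)) (zeroʳ a))

  constant-‿ : ∀ a → constant (- a) ≈ₛ -ₛ constant a
  constant-‿ a zero    = refl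
  constant-‿ a (suc n) = sym -0#≈0#

  constant-ι : ∀ n → ιₛ n ≈ₛ constant (ι n)
  constant-ι zero    zero    = refl
  constant-ι zero    (suc m) = refl
  constant-ι (suc n) m       = trans (+-congˡ (constant-ι n m)) (sym (constant-+ 1# (ι n) m))

  constant-^ : ∀ a n → constant a ^ₛ n ≈ₛ constant (a ^ n)
  constant-^ a zero    m = refl
  constant-^ a (suc n) m = trans (*ₛ-cong (λ _ → refl) (constant-^ a n) m) (sym (constant-* a (a ^ n) m))

  constant-ι-* : ∀ n a → constant (ι n * a) ≈ₛ ιₛ n *ₛ constant a
  constant-ι-* n a m = trans (constant-* (ι n) a m) (*ₛ-cong (λ k → sym (constant-ι n k)) (λ _ → refl) m)

  compSum≈^ₛ : ∀ r (f : Series) N → compSum r N f ≈ (f ^ₛ r) N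
  compSum≈^ₛ zero    f zero    = refl
  compSum≈^ₛ zero    f (suc N) = refl
  compSum≈^ₛ (suc r) f N       = trans (Σ0-cong N (λ j _ → *-congˡ (compSum≈^ₛ r f (N ∸ j)))) (reflexive (≡.sym (*ₛ-apply f (f ^ₛ r) N)))

  compSum-cong : ∀ r N {f g : Series} → f ≈ₛ g → compSum r N f ≈ compSum r N g
  compSum-cong r N {f} {g} f≈g = trans (compSum≈^ₛ r f N) (trans (^ₛ-congˡ r f≈g N) (sym (compSum≈^ₛ r g N)))

  compSum-scale : ∀ r N a (f : Series) → compSum r N (λ i → a * f i) ≈ a ^ r * compSum r N f
  compSum-scale r N a f = begin
    compSum r N (λ i → a * f i)            ≈⟨ compSum-cong r N (λ i → sym (constant-*ₛ a f i)) ⟩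
    compSum r N (constant a *ₛ f)          ≈⟨ compSum≈^ₛ r (constant a *ₛ f) N ⟩
    ((constant a *ₛ f) ^ₛ r) N             ≈⟨ ^ₛ-distrib-*ₛ (constant a) f r N ⟩
    (constant a ^ₛ r *ₛ f ^ₛ r) N          ≈⟨ *ₛ-cong (constant-^ a r) (λ _ → refl) N ⟩
    (constant (a ^ r) *ₛ f ^ₛ r) N         ≈⟨ constant-*ₛ (a ^ r) (f ^ₛ r) N ⟩
    a ^ r * (f ^ₛ r) N                     ≈⟨ *-congˡ (compSum≈^ₛ r f N) ⟨
    a ^ r * compSum r N f                  ∎

  X^-*ₛ : ∀ j h m → ((X ^ₛ j) *ₛ h) (j ℕ.+ m) ≈ h m
  X^-*ₛ zero    h m = *ₛ-identityˡ h m
  X^-*ₛ (suc j) h m = begin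
    ((X *ₛ X ^ₛ j) *ₛ h) (suc (j ℕ.+ m))     ≈⟨ *ₛ-assoc X (X ^ₛ j) h (suc (j ℕ.+ m)) ⟩
    (X *ₛ (X ^ₛ j *ₛ h)) (suc (j ℕ.+ m))     ≈⟨ X-*ₛ-suc (X ^ₛ j *ₛ h) (j ℕ.+ m) ⟩
    (X ^ₛ j *ₛ h) (j ℕ.+ m)                  ≈⟨ X^-*ₛ j h m ⟩
    h m                                      ∎

  scalar-ι-^ : ∀ m a e → ιₛ m *ₛ constant a ^ₛ e ≈ₛ constant (ι m * a ^ e)
  scalar-ι-^ m a e n = trans (*ₛ-cong (constant-ι m) (constant-^ a e) n) (sym (constant-* (ι m) (a ^ e) n))

  X-*ₛ-scalar : ∀ {κ} b h → κ ≈ₛ constant b → ∀ N → (X *ₛ (κ *ₛ h)) N ≈ b * (X *ₛ h) N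
  X-*ₛ-scalar {κ} b h κ≈b N = begin
    (X *ₛ (κ *ₛ h)) N             ≈⟨ *ₛ-assoc X κ h N ⟨
    ((X *ₛ κ) *ₛ h) N             ≈⟨ *ₛ-cong (*ₛ-comm X κ) (λ _ → refl) N ⟩
    ((κ *ₛ X) *ₛ h) N             ≈⟨ *ₛ-assoc κ X h N ⟩
    (κ *ₛ (X *ₛ h)) N             ≈⟨ *ₛ-cong κ≈b (λ _ → refl) N ⟩
    (constant b *ₛ (X *ₛ h)) N    ≈⟨ constant-*ₛ b (X *ₛ h) N ⟩
    b * (X *ₛ h) N                ∎

module LucasSequence {c ℓ : Level} (R : CommutativeRing c ℓ) (P Q : CommutativeRing.Carrier R) where
  open CommutativeRing R
  open RingOps R
  open PowerSeries R
  open IntegerCoefficientSolver R using (solve; _:=_; con; _:+_; _:*_; _:-_)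
  open import Relation.Binary.Reasoning.Setoid setoid

  lucas : ℕ → Carrier
  lucas zero          = 0#
  lucas (suc zero)    = 1#
  lucas (suc (suc m)) = P * lucas (suc m) - Q * lucas m

  F : Series
  F n = lucas (suc n)

  lucas≈X*F : lucas ≈ₛ X *ₛ F
  lucas≈X*F zero    = sym (X-*ₛ-zero F)
  lucas≈X*F (suc n) = sym (X-*ₛ-suc F n)

  F-recurrence : ∀ n → F n - P * (X *ₛ F) n + Q * (X *ₛ (X *ₛ F)) n ≈ constant 1# n
  F-recurrence zero = begin
    1# - P * (X *ₛ F) 0 + Q * (X *ₛ (X *ₛ F)) 0   ≈⟨ +-cong (+-congˡ (-‿cong (*-congˡ (X-*ₛ-zero F)))) (*-congˡ (X-*ₛ-zero (X *ₛ F))) ⟩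
    1# - P * 0# + Q * 0#                          ≈⟨ solve 2 (λ p q → con (+ 1) :- p :* con (+ 0) :+ q :* con (+ 0) := con (+ 1)) refl P Q ⟩
    1#                                            ∎
  F-recurrence (suc zero) = begin
    F 1 - P * (X *ₛ F) 1 + Q * (X *ₛ (X *ₛ F)) 1
      ≈⟨ +-cong (+-congˡ (-‿cong (*-congˡ (X-*ₛ-suc F 0)))) (*-congˡ (trans (X-*ₛ-suc (X *ₛ F) 0) (X-*ₛ-zero F))) ⟩
    (P * 1# - Q * 0#) - P * 1# + Q * 0#
      ≈⟨ solve 2 (λ p q → (p :* con (+ 1) :- q :* con (+ 0)) :- p :* con (+ 1) :+ q :* con (+ 0) := con (+ 0)) refl P Q ⟩
    0#                                            ∎
  F-recurrence (suc (suc m)) = begin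
    F (2 ℕ.+ m) - P * (X *ₛ F) (2 ℕ.+ m) + Q * (X *ₛ (X *ₛ F)) (2 ℕ.+ m)
      ≈⟨ +-cong (+-congˡ (-‿cong (*-congˡ (X-*ₛ-suc F (suc m))))) (*-congˡ (trans (X-*ₛ-suc (X *ₛ F) (suc m)) (X-*ₛ-suc F m))) ⟩
    (P * a - Q * b) - P * a + Q * b
      ≈⟨ solve 4 (λ p q a b → (p :* a :- q :* b) :- p :* a :+ q :* b := con (+ 0)) refl P Q a b ⟩
    0# ∎
    where
    a = lucas (2 ℕ.+ m)
    b = lucas (suc m)

module LucasGeneratingFunction {c ℓ : Level} (R : CommutativeRing c ℓ) (P Q : CommutativeRing.Carrier R) where
  open PowerSeries R
  open LucasSequence R P Q
  module R where
    open CommutativeRing R public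
    open RingOps R public
  open CommutativeRing seriesRing
  open RingOps seriesRing
  open RingOpsProperties seriesRing using (ι-*)
  open IntegerCoefficientSolver seriesRing using (solve; _:=_; con; _:+_; _:*_; :-_; _:-_)
  open import Algebra.Properties.Ring ring using (+-inverseʳ-unique)
  open import Relation.Binary.Reasoning.Setoid setoid
  module D = DerivationProperties seriesRing D-isDerivation

  twoQ Δ : R.Carrier
  twoQ = R.ι 2 R.* Q
  Δ    = P R.* P R.- R.ι 4 R.* Q

  c₄ cΔ c₋₂ : Series
  c₄  = constant (R.ι 4 R.* Q)
  cΔ  = constant Δ
  c₋₂ = constant (R.- twoQ)

  L g : Series
  L = 1# - constant P * X + constant Q * (X * X)
  g = constant P + c₋₂ * X

  -- The solver reads the constant 2 as 1# + 1#, not as ι 2, so the constants are restated via two.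
  two : Series
  two = 1# + 1#

  c₋₂≈-two*Q : c₋₂ ≈ - (two * constant Q)
  c₋₂≈-two*Q = begin
    constant (R.- twoQ)              ≈⟨ constant-‿ twoQ ⟩
    - constant twoQ                  ≈⟨ -‿cong (constant-ι-* 2 Q) ⟩
    - (ι 2 * constant Q)             ≈⟨ -‿cong (*-congʳ (+-congˡ (+-identityʳ 1#))) ⟩
    - (two * constant Q)             ∎

  c₄≈two*two*Q : c₄ ≈ two * two * constant Q
  c₄≈two*two*Q = trans (constant-ι-* 4 Q) (*-congʳ (solve 0 (con (+ 1) :+ (con (+ 1) :+ (con (+ 1) :+ (con (+ 1) :+ con (+ 0))))
                                                       := (con (+ 1) :+ con (+ 1)) :* (con (+ 1) :+ con (+ 1))) refl))

  cΔ≈P*P-two*two*Q : cΔ ≈ constant P * constant P - two * two * constant Q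
  cΔ≈P*P-two*two*Q = begin
    constant (P R.* P R.+ R.- (R.ι 4 R.* Q))           ≈⟨ constant-+ (P R.* P) _ ⟩
    constant (P R.* P) + constant (R.- (R.ι 4 R.* Q))  ≈⟨ +-cong (constant-* P P) (trans (constant-‿ _) (-‿cong c₄≈two*two*Q)) ⟩
    constant P * constant P - two * two * constant Q   ∎

  L*F≈1 : L * F ≈ 1#
  L*F≈1 = begin
    L * F                                                   ≈⟨ solve 4 (λ p q x f → (con (+ 1) :- p :* x :+ q :* (x :* x)) :* f
                                                                   := f :- p :* (x :* f) :+ q :* (x :* (x :* f))) refl (constant P) (constant Q) X F ⟩
    F - constant P * (X * F) + constant Q * (X * (X * F))
      ≈⟨ (λ n → R.trans (R.+-cong (R.+-congˡ (R.-‿cong (constant-*ₛ P (X * F) n))) (constant-*ₛ Q (X * (X * F)) n))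
                                                                                (F-recurrence n)) ⟩
    1#                                                      ∎

  open IsDerivation D-isDerivation using () renaming (leibniz to D-*)

  D-L : D L ≈ - g
  D-L = begin
    D L                                                   ≈⟨ D-+ _ _ ⟩
    D (1# - constant P * X) + D (constant Q * (X * X))
      ≈⟨ +-cong (trans (D-+ _ _) (+-cong D.δ-1 (D.δ-‿ _))) (D.δ-*-constantˡ (X * X) (D-constant Q)) ⟩
    0# - D (constant P * X) + constant Q * D (X * X)      ≈⟨ +-cong (+-congˡ (-‿cong (trans (D.δ-*-constantˡ X (D-constant P)) (*-congˡ D-X))))
                                                                    (*-congˡ (trans (D-* X X) (+-cong (*-congʳ D-X) (*-congˡ D-X)))) ⟩
    0# - constant P * 1# + constant Q * (1# * X + X * 1#) ≈⟨ solve 3 (λ p q x → con (+ 0) :- p :* con (+ 1) :+ q :* (con (+ 1) :* x :+ x :* con (+ 1))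
                                                                   := :- (p :+ (:- ((con (+ 1) :+ con (+ 1)) :* q)) :* x)) refl (constant P) (constant Q) X ⟩
    - (constant P + - (two * constant Q) * X)             ≈⟨ -‿cong (+-congˡ (*-congʳ c₋₂≈-two*Q)) ⟨
    - g                                                   ∎

  D-F : D F ≈ F * (g * F)
  D-F = begin
    D F              ≈⟨ *-identityˡ _ ⟨
    1# * D F         ≈⟨ *-congʳ (trans (sym L*F≈1) (*-comm L F)) ⟩
    (F * L) * D F    ≈⟨ *-assoc F L (D F) ⟩
    F * (L * D F)    ≈⟨ *-congˡ L*DF≈g*F ⟩
    F * (g * F)      ∎
    where
    L*DF≈g*F : L * D F ≈ g * F
    L*DF≈g*F = begin
      L * D F        ≈⟨ +-inverseʳ-unique (D L * F) (L * D F) (trans (sym (D-* L F)) (trans (D-cong L*F≈1) D.δ-1)) ⟩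
      - (D L * F)    ≈⟨ -‿cong (*-congʳ D-L) ⟩
      - (- g * F)    ≈⟨ solve 2 (λ g f → :- ((:- g) :* f) := g :* f) refl g F ⟩
      g * F          ∎

  g*g : g * g ≈ c₄ * L + cΔ
  g*g = begin
    g * g                                       ≈⟨ *-cong g≈ g≈ ⟩
    (constant P + - (two * constant Q) * X) * (constant P + - (two * constant Q) * X)
      ≈⟨ solve 3 (λ p q x → (p :+ (:- (t :* q)) :* x) :* (p :+ (:- (t :* q)) :* x)
                           := t :* t :* q :* (con (+ 1) :- p :* x :+ q :* (x :* x)) :+ (p :* p :- t :* t :* q)) refl (constant P) (constant Q) X ⟩
    two * two * constant Q * L + (constant P * constant P - two * two * constant Q)
      ≈⟨ +-cong (*-congʳ c₄≈two*two*Q) cΔ≈P*P-two*two*Q ⟨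
    c₄ * L + cΔ                                 ∎
    where
    t = con (+ 1) :+ con (+ 1)
    g≈ : g ≈ constant P + - (two * constant Q) * X
    g≈ = +-congˡ (*-congʳ c₋₂≈-two*Q)

  Θ : Series → Series
  Θ f = g * D f

  Θ-isDerivation : IsDerivation seriesRing Θ
  Θ-isDerivation = D.scaled-isDerivation g

  module Θ = DerivationProperties seriesRing Θ-isDerivation
  open IsDerivation Θ-isDerivation using () renaming (leibniz to Θ-*)

  Θ-constant : ∀ {a} → D a ≈ 0# → Θ a ≈ 0#
  Θ-constant Da≈0 = trans (*-congˡ Da≈0) (zeroʳ g)

  Θ-F : Θ F ≈ c₄ * F + cΔ * (F * F)
  Θ-F = begin
    g * D F                      ≈⟨ *-congˡ D-F ⟩
    g * (F * (g * F))            ≈⟨ solve 2 (λ g f → g :* (f :* (g :* f)) := (g :* g) :* (f :* f)) refl g F ⟩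
    (g * g) * (F * F)            ≈⟨ *-congʳ g*g ⟩
    (c₄ * L + cΔ) * (F * F)      ≈⟨ solve 4 (λ a l d f → (a :* l :+ d) :* (f :* f) := a :* (l :* f) :* f :+ d :* (f :* f)) refl c₄ L cΔ F ⟩
    c₄ * (L * F) * F + cΔ * (F * F)  ≈⟨ +-congʳ (*-congʳ (trans (*-congˡ L*F≈1) (*-identityʳ c₄))) ⟩
    c₄ * F + cΔ * (F * F)        ∎

  leftFamily : ℕ → Series
  leftFamily j = ι (j !) * cΔ ^ j * F ^ suc j

  left-raising : ∀ j → Θ (leftFamily j) ≈ ι (1 ℕ.+ j) * c₄ * leftFamily j + leftFamily (suc j)
  left-raising j = begin
    Θ (ι (j !) * cΔ ^ j * F ^ suc j)
      ≈⟨ Θ.δ-*-constantˡ (F ^ suc j) (Θ-constant D-coefficient) ⟩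
    ι (j !) * cΔ ^ j * Θ (F ^ suc j)
      ≈⟨ *-congˡ (trans (Θ.δ-^ F j) (*-congˡ Θ-F)) ⟩
    ι (j !) * cΔ ^ j * (ι (suc j) * F ^ j * (c₄ * F + cΔ * (F * F)))
      ≈⟨ solve 7 (λ a k d dj f fj c → a :* dj :* (k :* fj :* (c :* f :+ d :* (f :* f)))
                                     := k :* c :* (a :* dj :* (f :* fj)) :+ k :* a :* (d :* dj) :* (f :* (f :* fj)))
                 refl (ι (j !)) (ι (suc j)) cΔ (cΔ ^ j) F (F ^ j) c₄ ⟩
    ι (suc j) * c₄ * leftFamily j + ι (suc j) * ι (j !) * cΔ ^ suc j * F ^ suc (suc j)
      ≈⟨ +-congˡ (*-congʳ (*-congʳ (ι-* (suc j) (j !)))) ⟨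
    ι (suc j) * c₄ * leftFamily j + leftFamily (suc j) ∎
    where
    D-coefficient : D (ι (j !) * cΔ ^ j) ≈ 0#
    D-coefficient = trans (D.δ-*-constantˡ (cΔ ^ j) (D.δ-ι (j !))) (trans (*-congˡ (D.δ-^-constant j (D-constant Δ))) (zeroʳ _))

  rightFamily : ℕ → Series
  rightFamily j = g ^ suc j * iterate D F (suc j)

  D-g : D g ≈ c₋₂
  D-g = begin
    D (constant P + c₋₂ * X)     ≈⟨ D-+ _ _ ⟩
    D (constant P) + D (c₋₂ * X) ≈⟨ +-cong (D-constant P) (trans (D.δ-*-constantˡ X (D-constant (R.- twoQ))) (*-congˡ D-X)) ⟩
    0# + c₋₂ * 1#                ≈⟨ trans (+-identityˡ _) (*-identityʳ c₋₂) ⟩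
    c₋₂                          ∎

  right-raising : ∀ j → Θ (rightFamily j) ≈ ι (1 ℕ.+ j) * c₋₂ * rightFamily j + rightFamily (suc j)
  right-raising j = begin
    Θ (g ^ suc j * A)                         ≈⟨ Θ-* (g ^ suc j) A ⟩
    g * D (g ^ suc j) * A + g ^ suc j * (g * D A)
      ≈⟨ +-cong (*-congʳ (*-congˡ (trans (D.δ-^ g j) (*-congˡ D-g)))) (*-congˡ (*-congˡ (reflexive (≡.sym (iterate-suc D F (suc j)))))) ⟩
    g * (ι (suc j) * g ^ j * c₋₂) * A + g ^ suc j * (g * B)
      ≈⟨ solve 6 (λ g gj k c a b → g :* (k :* gj :* c) :* a :+ (g :* gj) :* (g :* b)
                                  := k :* c :* ((g :* gj) :* a) :+ (g :* (g :* gj)) :* b) refl g (g ^ j) (ι (suc j)) c₋₂ A B ⟩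
    ι (suc j) * c₋₂ * rightFamily j + rightFamily (suc j) ∎
    where
    A = iterate D F (suc j)
    B = iterate D F (suc (suc j))

  module LeftExpansion  = Θ.RaisingExpansion 1 c₄  (Θ-constant (D-constant _)) leftFamily  left-raising
  module RightExpansion = Θ.RaisingExpansion 1 c₋₂ (Θ-constant (D-constant _)) rightFamily right-raising

  -- Both sides expand Θ^{d+1} F; the right-hand family starts from Θ F = g · D F.
  Θ-expansions : ∀ d →
    Σ0 (suc d) (λ j → LeftExpansion.coefficient (suc d) j * leftFamily j) ≈ Σ0 d (λ j → RightExpansion.coefficient d j * rightFamily j)
  Θ-expansions d = begin
    Σ0 (suc d) (λ j → LeftExpansion.coefficient (suc d) j * leftFamily j) ≈⟨ LeftExpansion.expansion (suc d) ⟨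
    iterate Θ (leftFamily 0) (suc d)                                      ≈⟨ Θ.iterate-cong (suc d) leftFamily₀≈F ⟩
    iterate Θ (Θ F) d                                                     ≈⟨ Θ.iterate-cong d (*-congʳ (sym (*-identityʳ g))) ⟩
    iterate Θ (rightFamily 0) d                                           ≈⟨ RightExpansion.expansion d ⟩
    Σ0 d (λ j → RightExpansion.coefficient d j * rightFamily j)           ∎
    where
    leftFamily₀≈F : leftFamily 0 ≈ F
    leftFamily₀≈F = solve 1 (λ f → (con (+ 1) :+ con (+ 0)) :* con (+ 1) :* (f :* con (+ 1)) := f) refl F

module LucasCoefficients {c ℓ : Level} (R : CommutativeRing c ℓ) (P Q : CommutativeRing.Carrier R) where
  open CommutativeRing R
  open RingOps R
  open RingOpsProperties R
  open PowerSeries R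
  open LucasSequence R P Q
  open LucasGeneratingFunction R P Q using (twoQ; Δ; g; c₋₂; leftFamily; rightFamily; module LeftExpansion; module RightExpansion; Θ-expansions)
  open IntegerCoefficientSolver R using (solve; _:=_; con; _:+_; _:*_; _:-_)
  module S = CommutativeRing seriesRing
  module SP = RingOpsProperties seriesRing
  open import Algebra.Properties.CommutativeSemigroup S.*-commutativeSemigroup using (x∙yz≈y∙xz)
  open import Relation.Binary.Reasoning.Setoid setoid

  g-*ₛ : ∀ h t → (g *ₛ h) t ≈ P * h t + (- twoQ) * (X *ₛ h) t
  g-*ₛ h t = begin
    ((constant P +ₛ c₋₂ *ₛ X) *ₛ h) t             ≈⟨ S.distribʳ h (constant P) (c₋₂ *ₛ X) t ⟩
    (constant P *ₛ h) t + ((c₋₂ *ₛ X) *ₛ h) t     ≈⟨ +-cong (constant-*ₛ P h t) (trans (*ₛ-assoc c₋₂ X h t) (constant-*ₛ (- twoQ) (X *ₛ h) t)) ⟩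
    P * h t + (- twoQ) * (X *ₛ h) t               ∎

  g^-coefficient : ∀ j t → (g ^ₛ j) t ≈ ι (j C t) * (P ^ (j ∸ t) * (- twoQ) ^ t)
  g^-coefficient zero    zero    = solve 0 (con (+ 1) := (con (+ 1) :+ con (+ 0)) :* (con (+ 1) :* con (+ 1))) refl
  g^-coefficient zero    (suc t) = sym (zeroˡ _)
  g^-coefficient (suc j) zero    = begin
    (g *ₛ g ^ₛ j) 0                                ≈⟨ g-*ₛ (g ^ₛ j) 0 ⟩
    P * (g ^ₛ j) 0 + (- twoQ) * (X *ₛ g ^ₛ j) 0    ≈⟨ +-cong (*-congˡ (g^-coefficient j 0)) (*-congˡ (X-*ₛ-zero (g ^ₛ j))) ⟩
    P * (ι 1 * (P ^ j * 1#)) + (- twoQ) * 0#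
      ≈⟨ solve 4 (λ p m c x → p :* (c :* (x :* con (+ 1))) :+ m :* con (+ 0) := c :* ((p :* x) :* con (+ 1))) refl P (- twoQ) (ι 1) (P ^ j) ⟩
    ι 1 * (P ^ suc j * 1#)                         ∎
  g^-coefficient (suc j) (suc t) = begin
    (g *ₛ g ^ₛ j) (suc t)                                   ≈⟨ g-*ₛ (g ^ₛ j) (suc t) ⟩
    P * (g ^ₛ j) (suc t) + m * (X *ₛ g ^ₛ j) (suc t)
      ≈⟨ +-cong (*-congˡ (g^-coefficient j (suc t))) (*-congˡ (trans (X-*ₛ-suc (g ^ₛ j) t) (g^-coefficient j t))) ⟩
    P * (ι (j C suc t) * (P ^ (j ∸ suc t) * m ^ suc t)) + m * (ι (j C t) * (P ^ (j ∸ t) * m ^ t))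
      ≈⟨ +-congʳ (solve 4 (λ p c x y → p :* (c :* (x :* y)) := c :* (p :* x) :* y) refl P _ _ _) ⟩
    ι (j C suc t) * (P * P ^ (j ∸ suc t)) * m ^ suc t + m * (ι (j C t) * (P ^ (j ∸ t) * m ^ t))
      ≈⟨ +-congʳ (*-congʳ (*-^-∸-suc (ι (j C suc t)) P j t (λ j≤t → reflexive (≡.cong ι (k>n⇒nCk≡0 (s≤s j≤t)))))) ⟩
    ι (j C suc t) * P ^ (j ∸ t) * m ^ suc t + m * (ι (j C t) * (P ^ (j ∸ t) * m ^ t))
      ≈⟨ solve 5 (λ a b m x y → a :* x :* (m :* y) :+ m :* (b :* (x :* y)) := (b :+ a) :* (x :* (m :* y))) refl _ _ m _ _ ⟩
    (ι (j C t) + ι (j C suc t)) * (P ^ (j ∸ t) * m ^ suc t)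
      ≈⟨ *-congʳ (trans (sym (ι-+ (j C t) _)) (reflexive (≡.cong ι (nCk+nC[k+1]≡[n+1]C[k+1] j t)))) ⟩
    ι (suc j C suc t) * (P ^ (suc j ∸ suc t) * m ^ suc t) ∎
    where m = - twoQ

  π : ℕ → ℕ → Carrier
  π j y = Π1 j (λ i → ι y - ι i)

  π-lucas-vanishes : ∀ {j y} → y ≤ j → π j y * lucas y ≈ 0#
  π-lucas-vanishes {j} {zero}  _   = zeroʳ _
  π-lucas-vanishes {j} {suc y} y≤j = trans (*-congʳ (Π1-zero j _ (s≤s z≤n) y≤j (-‿inverseʳ (ι (suc y))))) (zeroˡ _)

  iterate-D-F : ∀ j m → iterate D F j m ≈ π j (suc (j ℕ.+ m)) * lucas (suc (j ℕ.+ m))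
  iterate-D-F zero    m = sym (*-identityˡ _)
  iterate-D-F (suc j) m = begin
    iterate D F (suc j) m                            ≡⟨ ≡.trans (≡.cong (λ h → h m) (iterate-suc D F j)) (D-apply (iterate D F j) m) ⟩
    ι (suc m) * iterate D F j (suc m)                ≈⟨ *-congˡ (iterate-D-F j (suc m)) ⟩
    ι (suc m) * (π j (suc (j ℕ.+ suc m)) * lucas (suc (j ℕ.+ suc m)))
                                                     ≡⟨ ≡.cong (λ y → ι (suc m) * (π j y * lucas y)) (≡.cong suc (ℕ.+-suc j m)) ⟩
    ι (suc m) * (π j y * lucas y)                    ≈⟨ solve 3 (λ a b c → a :* (b :* c) := (b :* a) :* c) refl _ _ _ ⟩
    (π j y * ι (suc m)) * lucas y                    ≈⟨ *-congʳ (*-congˡ ι[1+m]≈) ⟩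
    (π j y * (ι y - ι (suc j))) * lucas y            ∎
    where
    y = suc (suc j ℕ.+ m)
    ι[1+m]≈ : ι (suc m) ≈ ι y - ι (suc j)
    ι[1+m]≈ = begin
      ι (suc m)                              ≈⟨ solve 2 (λ a b → a := (b :+ a) :- b) refl _ _ ⟩
      (ι (suc j) + ι (suc m)) - ι (suc j)    ≈⟨ +-congʳ (ι-+ (suc j) (suc m)) ⟨
      ι (suc j ℕ.+ suc m) - ι (suc j)        ≡⟨ ≡.cong (λ k → ι k - ι (suc j)) (ℕ.+-suc (suc j) m) ⟩
      ι y - ι (suc j)                        ∎

  X-*ₛ-iterate-D-F : ∀ j m → (X *ₛ iterate D F j) m ≈ π j (m ℕ.+ j) * lucas (m ℕ.+ j)
  X-*ₛ-iterate-D-F j zero    = trans (X-*ₛ-zero _) (sym (π-lucas-vanishes {j} ℕ.≤-refl))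
  X-*ₛ-iterate-D-F j (suc m) = trans (X-*ₛ-suc _ m) (trans (iterate-D-F j m)
    (reflexive (≡.cong (λ y → π j y * lucas y) (≡.cong suc (ℕ.+-comm j m)))))

  rightInner : ℕ → ℕ → Carrier
  rightInner j N = Σ0 j (λ t → ι (j C t) * ((- twoQ) ^ t * P ^ (j ∸ t) * π j (N ℕ.+ j ∸ t)) * lucas (N ℕ.+ j ∸ t))

  rightInner≈ : ∀ j N → rightInner j N ≈ (X *ₛ (g ^ₛ j *ₛ iterate D F j)) N
  rightInner≈ j N = begin
    Σ0 j term                                                  ≈⟨ Σ0-support j N term beyond-j beyond-N ⟩
    Σ0 N term                                                  ≈⟨ Σ0-cong N (λ t t≤N → sym (convolution-term t t≤N)) ⟩
    Σ0 N (λ t → (g ^ₛ j) t * (X *ₛ iterate D F j) (N ∸ t))     ≡⟨ *ₛ-apply (g ^ₛ j) (X *ₛ iterate D F j) N ⟨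
    (g ^ₛ j *ₛ (X *ₛ iterate D F j)) N                         ≈⟨ X-commutes N ⟩
    (X *ₛ (g ^ₛ j *ₛ iterate D F j)) N                         ∎
    where
    term : ℕ → Carrier
    term t = ι (j C t) * ((- twoQ) ^ t * P ^ (j ∸ t) * π j (N ℕ.+ j ∸ t)) * lucas (N ℕ.+ j ∸ t)
    beyond-j : ∀ t → j < t → t ≤ N → term t ≈ 0#
    beyond-j t j<t _ = trans (*-congʳ (trans (*-congʳ (reflexive (≡.cong ι (k>n⇒nCk≡0 j<t)))) (zeroˡ _))) (zeroˡ _)
    beyond-N : ∀ t → N < t → t ≤ j → term t ≈ 0#
    beyond-N t N<t _ = begin
      term t                                                    ≈⟨ solve 4 (λ c a p l → c :* (a :* p) :* l := c :* a :* (p :* l)) refl _ _ _ _ ⟩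
      ι (j C t) * ((- twoQ) ^ t * P ^ (j ∸ t)) * (π j y * lucas y)
        ≈⟨ *-congˡ (π-lucas-vanishes {j} (ℕ.m≤n+o⇒m∸n≤o (N ℕ.+ j) t (ℕ.+-monoˡ-≤ j (ℕ.<⇒≤ N<t)))) ⟩
      ι (j C t) * ((- twoQ) ^ t * P ^ (j ∸ t)) * 0#             ≈⟨ zeroʳ _ ⟩
      0#                                                        ∎
      where y = N ℕ.+ j ∸ t
    convolution-term : ∀ t → t ≤ N → (g ^ₛ j) t * (X *ₛ iterate D F j) (N ∸ t) ≈ term t
    convolution-term t t≤N = begin
      (g ^ₛ j) t * (X *ₛ iterate D F j) (N ∸ t)
        ≈⟨ *-cong (g^-coefficient j t) (X-*ₛ-iterate-D-F j (N ∸ t)) ⟩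
      ι (j C t) * (P ^ (j ∸ t) * (- twoQ) ^ t) * (π j (N ∸ t ℕ.+ j) * lucas (N ∸ t ℕ.+ j))
        ≡⟨ ≡.cong (λ y → ι (j C t) * (P ^ (j ∸ t) * (- twoQ) ^ t) * (π j y * lucas y)) (≡.sym (ℕ.+-∸-comm j t≤N)) ⟩
      ι (j C t) * (P ^ (j ∸ t) * (- twoQ) ^ t) * (π j (N ℕ.+ j ∸ t) * lucas (N ℕ.+ j ∸ t))
        ≈⟨ solve 5 (λ c p m a l → c :* (p :* m) :* (a :* l) := c :* (m :* p :* a) :* l) refl _ _ _ _ _ ⟩
      term t ∎
    X-commutes : ∀ N → (g ^ₛ j *ₛ (X *ₛ iterate D F j)) N ≈ (X *ₛ (g ^ₛ j *ₛ iterate D F j)) N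
    X-commutes = x∙yz≈y∙xz (g ^ₛ j) X (iterate D F j)

  compSum-lucas : ∀ j N → compSum (suc j) (j ℕ.+ N) lucas ≈ (X *ₛ F ^ₛ suc j) N
  compSum-lucas j N = begin
    compSum (suc j) (j ℕ.+ N) lucas           ≈⟨ compSum≈^ₛ (suc j) lucas (j ℕ.+ N) ⟩
    (lucas ^ₛ suc j) (j ℕ.+ N)                ≈⟨ SP.^-congˡ (suc j) lucas≈X*F (j ℕ.+ N) ⟩
    ((X *ₛ F) ^ₛ suc j) (j ℕ.+ N)             ≈⟨ SP.^-distrib-* X F (suc j) (j ℕ.+ N) ⟩
    ((X *ₛ X ^ₛ j) *ₛ F ^ₛ suc j) (j ℕ.+ N)   ≈⟨ S.trans (S.*-assoc X (X ^ₛ j) (F ^ₛ suc j)) (x∙yz≈y∙xz X (X ^ₛ j) (F ^ₛ suc j)) (j ℕ.+ N) ⟩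
    (X ^ₛ j *ₛ (X *ₛ F ^ₛ suc j)) (j ℕ.+ N)   ≈⟨ X^-*ₛ j (X *ₛ F ^ₛ suc j) N ⟩
    (X *ₛ F ^ₛ suc j) N                       ∎

  -- The coefficient of x^N in X · Θ^{D+1} F, read off from both expansions.
  lucas-coefficient-identity : ∀ D N →
    Σ0 (suc D) (λ j → ι (rStirling 1 (suc D) j) * (ι 4 * Q) ^ (suc D ∸ j) * (ι (j !) * Δ ^ j * (X *ₛ F ^ₛ suc j) N))
    ≈ Σ0 D (λ j → ι (rStirling 1 D j) * (- twoQ) ^ (D ∸ j) * rightInner (suc j) N)
  lucas-coefficient-identity D N = begin
    Σ0 (suc D) (λ j → ι (rStirling 1 (suc D) j) * (ι 4 * Q) ^ (suc D ∸ j) * (ι (j !) * Δ ^ j * (X *ₛ F ^ₛ suc j) N))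
      ≈⟨ Σ0-cong (suc D) (λ j _ → sym (trans (scaled (ι 4 * Q) (rStirling 1 (suc D) j) (suc D ∸ j) (leftFamily j))
                                              (*-congˡ (scaled Δ (j !) j (F ^ₛ suc j))))) ⟩
    Σ0 (suc D) (λ j → (X *ₛ (LeftExpansion.coefficient (suc D) j *ₛ leftFamily j)) N)
      ≈⟨ X-Σ0 (suc D) _ ⟨
    (X *ₛ Σ0ₛ (suc D) (λ j → LeftExpansion.coefficient (suc D) j *ₛ leftFamily j)) N
      ≈⟨ *ₛ-cong (λ _ → refl) (Θ-expansions D) N ⟩
    (X *ₛ Σ0ₛ D (λ j → RightExpansion.coefficient D j *ₛ rightFamily j)) N
      ≈⟨ X-Σ0 D _ ⟩
    Σ0 D (λ j → (X *ₛ (RightExpansion.coefficient D j *ₛ rightFamily j)) N)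
      ≈⟨ Σ0-cong D (λ j _ → trans (scaled (- twoQ) (rStirling 1 D j) (D ∸ j) (rightFamily j)) (*-congˡ (sym (rightInner≈ (suc j) N)))) ⟩
    Σ0 D (λ j → ι (rStirling 1 D j) * (- twoQ) ^ (D ∸ j) * rightInner (suc j) N) ∎
    where
    X-Σ0 : ∀ n h → (X *ₛ Σ0ₛ n h) N ≈ Σ0 n (λ j → (X *ₛ h j) N)
    X-Σ0 n h = trans (SP.*-distribˡ-Σ0 n X h N) (Σ0ₛ-apply n (λ j → X *ₛ h j) N)
    scaled : ∀ a m e h → (X *ₛ (ιₛ m *ₛ constant a ^ₛ e *ₛ h)) N ≈ ι m * a ^ e * (X *ₛ h) N
    scaled a m e h = X-*ₛ-scalar (ι m * a ^ e) h (scalar-ι-^ m a e) N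

module LucasNumbers {c ℓ : Level} (𝔽 : Char0Field c ℓ) where
  open Char0Field 𝔽
  open FieldOps 𝔽 using (half; invFact; module Lucas)
  open RingOpsProperties cring
  open RStirlingExplicit cring using (alternatingPowerSum; rStirling-explicit; rStirling-explicit-reversed)
  open PowerSeries cring using (X; _*ₛ_; _^ₛ_; compSum-cong; compSum-scale)
  open IntegerCoefficientSolver cring using (solve; _:=_; con; _:+_; _:*_; _:-_)
  open import Algebra.Properties.Ring ring using (-1*x≈-x)
  open import Relation.Binary.Reasoning.Setoid setoid

  module Terms (p q δ : Carrier) (δ≉0 : ¬ (δ ≈ 0#)) (sq : δ * δ ≈ p * p - ι 4 * q) (k : ℕ) where
    open Lucas p q δ δ≉0
    open LucasSequence cring (V k) (q ^ k) using (lucas; F)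
    open LucasGeneratingFunction cring (V k) (q ^ k) using (twoQ; Δ)
    open LucasCoefficients cring (V k) (q ^ k) using (rightInner; compSum-lucas)

    α*β≈q : α * β ≈ q
    α*β≈q = begin
      ((p + δ) * half) * ((p - δ) * half)
        ≈⟨ solve 3 (λ p d h → ((p :+ d) :* h) :* ((p :- d) :* h) := (p :* p :- d :* d) :* (h :* h)) refl p δ half ⟩
      (p * p - δ * δ) * (half * half)              ≈⟨ *-congʳ (+-congˡ (-‿cong (trans sq (+-congˡ (-‿cong (*-congʳ (ι-* 2 2))))))) ⟩
      (p * p - (p * p - ι 2 * ι 2 * q)) * (half * half)
        ≈⟨ solve 4 (λ p t q h → (p :* p :- (p :* p :- t :* t :* q)) :* (h :* h) := q :* ((t :* h) :* (t :* h))) refl p (ι 2) q half ⟩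
      q * ((ι 2 * half) * (ι 2 * half))            ≈⟨ *-congˡ (*-cong ι2*half≈1 ι2*half≈1) ⟩
      q * (1# * 1#)                                ≈⟨ trans (*-congˡ (*-identityˡ 1#)) (*-identityʳ q) ⟩
      q                                            ∎
      where
      ι2*half≈1 : ι 2 * half ≈ 1#
      ι2*half≈1 = inverseʳ (ι 2) (char0 1)

    U-step : ∀ t → U (k ℕ.+ (k ℕ.+ t)) ≈ V k * U (k ℕ.+ t) - q ^ k * U t
    U-step t = begin
      (α ^ (k ℕ.+ (k ℕ.+ t)) - β ^ (k ℕ.+ (k ℕ.+ t))) * δ⁻¹
        ≈⟨ *-congʳ (+-cong (trans (^-homo-* α k _) (*-congˡ (^-homo-* α k t))) (-‿cong (trans (^-homo-* β k _) (*-congˡ (^-homo-* β k t))))) ⟩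
      (a * (a * A) - b * (b * B)) * δ⁻¹
        ≈⟨ solve 5 (λ a b A B i → (a :* (a :* A) :- b :* (b :* B)) :* i := (a :+ b) :* ((a :* A :- b :* B) :* i) :- (a :* b) :* ((A :- B) :* i)) refl a b A B δ⁻¹ ⟩
      V k * ((a * A - b * B) * δ⁻¹) - (a * b) * ((A - B) * δ⁻¹)
        ≈⟨ +-cong (*-congˡ (*-congʳ (sym (+-cong (^-homo-* α k t) (-‿cong (^-homo-* β k t)))))) (-‿cong (*-congʳ (trans (sym (^-distrib-* α β k)) (^-congˡ k α*β≈q)))) ⟩
      V k * U (k ℕ.+ t) - q ^ k * U t ∎
      where
      δ⁻¹ = inv δ δ≉0
      a = α ^ k
      b = β ^ k
      A = α ^ t
      B = β ^ t

    U-multiple : ∀ m → U (m ℕ.* k) ≈ U k * lucas m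
    U-multiple zero          = trans (*-congʳ (-‿inverseʳ 1#)) (trans (zeroˡ _) (sym (zeroʳ _)))
    U-multiple (suc zero)    = trans (reflexive (≡.cong U (ℕ.+-identityʳ k))) (sym (*-identityʳ _))
    U-multiple (suc (suc m)) = begin
      U (k ℕ.+ (k ℕ.+ m ℕ.* k))                          ≈⟨ U-step (m ℕ.* k) ⟩
      V k * U (suc m ℕ.* k) - q ^ k * U (m ℕ.* k)        ≈⟨ +-cong (*-congˡ (U-multiple (suc m))) (-‿cong (*-congˡ (U-multiple m))) ⟩
      V k * (U k * lucas (suc m)) - q ^ k * (U k * lucas m)
        ≈⟨ solve 5 (λ p q u a b → p :* (u :* a) :- q :* (u :* b) := u :* (p :* a :- q :* b)) refl (V k) (q ^ k) (U k) _ _ ⟩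
      U k * lucas (suc (suc m))                          ∎

    s≈U^r*compSum : ∀ r N → s r N k ≈ U k ^ r * compSum r N lucas
    s≈U^r*compSum r N = trans (compSum-cong r N (λ j → trans (reflexive (≡.cong U (ℕ.*-comm k j))) (U-multiple j))) (compSum-scale r N (U k) lucas)

    leftSummand : ℕ → ℕ → ℕ → Carrier
    leftSummand d N j = ι (rStirling 1 d j) * (ι 4 * q ^ k) ^ (d ∸ j) * (ι (j !) * Δ ^ j * (X *ₛ F ^ₛ suc j) N)

    rightSummand : ℕ → ℕ → ℕ → Carrier
    rightSummand D N j = ι (rStirling 1 D j) * (- twoQ) ^ (D ∸ j) * rightInner (suc j) N

    left-term : (Uk≉0 : ¬ (U k ≈ 0#)) → ∀ {d n} → d ≤ n → ∀ j →
        (ι 4 * q ^ k) ^ (d ∸ j) * Σ0 j (λ i → (- 1#) ^ i * ι (j C i) * ι ((j ℕ.+ 1 ∸ i) ℕ.^ d))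
      * ((V k * V k - ι 4 * q ^ k) * inv (U k) Uk≉0) ^ j * s (j ℕ.+ 1) (n ℕ.+ j ∸ d) k
      ≈ U k * leftSummand d (n ∸ d) j
    left-term Uk≉0 {d} {n} d≤n j = begin
      κ * Σ0 j (λ i → (- 1#) ^ i * ι (j C i) * ι ((j ℕ.+ 1 ∸ i) ℕ.^ d)) * (Δ * u⁻¹) ^ j * s (j ℕ.+ 1) (n ℕ.+ j ∸ d) k
        ≈⟨ *-cong (*-cong (*-congˡ (rStirling-explicit-reversed 1 d j)) (^-distrib-* Δ u⁻¹ j)) s-term ⟩
      κ * (ι (j !) * S) * (Δ ^ j * u⁻¹ ^ j) * (U k * U k ^ j * Xf)
        ≈⟨ solve 8 (λ c f S d i u uj x → c :* (f :* S) :* (d :* i) :* (u :* uj :* x) := u :* (S :* c :* (f :* d :* x)) :* (i :* uj))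
                   refl κ (ι (j !)) S (Δ ^ j) (u⁻¹ ^ j) (U k) (U k ^ j) Xf ⟩
      U k * leftSummand d (n ∸ d) j * (u⁻¹ ^ j * U k ^ j)
        ≈⟨ trans (*-congˡ u⁻¹^j*U^j≈1) (*-identityʳ _) ⟩
      U k * leftSummand d (n ∸ d) j ∎
      where
      κ  = (ι 4 * q ^ k) ^ (d ∸ j)
      S  = ι (rStirling 1 d j)
      u⁻¹ = inv (U k) Uk≉0
      Xf = (X *ₛ F ^ₛ suc j) (n ∸ d)
      u⁻¹^j*U^j≈1 : u⁻¹ ^ j * U k ^ j ≈ 1#
      u⁻¹^j*U^j≈1 = trans (sym (^-distrib-* u⁻¹ (U k) j)) (trans (^-congˡ j (trans (*-comm u⁻¹ (U k)) (inverseʳ (U k) Uk≉0))) (1^n≈1 j))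
      index : n ℕ.+ j ∸ d ≡.≡ j ℕ.+ (n ∸ d)
      index = ≡.trans (ℕ.+-∸-comm j d≤n) (ℕ.+-comm (n ∸ d) j)
      s-term : s (j ℕ.+ 1) (n ℕ.+ j ∸ d) k ≈ U k * U k ^ j * Xf
      s-term = begin
        s (j ℕ.+ 1) (n ℕ.+ j ∸ d) k                    ≡⟨ ≡.cong₂ (λ r m → s r m k) (ℕ.+-comm j 1) index ⟩
        s (suc j) (j ℕ.+ (n ∸ d)) k                     ≈⟨ s≈U^r*compSum (suc j) (j ℕ.+ (n ∸ d)) ⟩
        U k ^ suc j * compSum (suc j) (j ℕ.+ (n ∸ d)) lucas ≈⟨ *-congˡ (compSum-lucas j (n ∸ d)) ⟩
        U k * U k ^ j * Xf                              ∎

    right-term : ∀ {D n} → suc D ≤ n → ∀ J → J ≤ D →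
        (- 1#) ^ D * (ι 2 * q ^ k) ^ (D ∸ J) * invFact J * alternatingPowerSum 1 D J
      * Σ0 (suc J) (λ t → ι (suc J C t) * ((- (ι 2 * q ^ k)) ^ t * V k ^ (suc J ∸ t)
                            * Π1 (suc J) (λ i → ι (n ℕ.+ suc J ∸ suc D ∸ t) - ι i)) * U ((n ℕ.+ suc J ∸ suc D ∸ t) ℕ.* k))
      ≈ U k * rightSummand D (n ∸ suc D) J
    right-term {D} {n} d≤n J J≤D = begin
      (- 1#) ^ D * T ^ (D ∸ J) * invFact J * alternatingPowerSum 1 D J * inner
        ≈⟨ *-cong (*-congˡ (rStirling-explicit 1 D J)) inner≈ ⟩
      (- 1#) ^ D * T ^ (D ∸ J) * invFact J * ((- 1#) ^ J * ι (J !) * S) * (U k * rightInner (suc J) N)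
        ≈⟨ *-congʳ coefficient ⟩
      S * (- T) ^ (D ∸ J) * (U k * rightInner (suc J) N)
        ≈⟨ solve 3 (λ a u r → a :* (u :* r) := u :* (a :* r)) refl _ _ _ ⟩
      U k * rightSummand D N J ∎
      where
      T = ι 2 * q ^ k
      S = ι (rStirling 1 D J)
      N = n ∸ suc D
      inner = Σ0 (suc J) (λ t → ι (suc J C t) * ((- T) ^ t * V k ^ (suc J ∸ t) * Π1 (suc J) (λ i → ι (n ℕ.+ suc J ∸ suc D ∸ t) - ι i))
                                * U ((n ℕ.+ suc J ∸ suc D ∸ t) ℕ.* k))
      inner≈ : inner ≈ U k * rightInner (suc J) N
      inner≈ rewrite ℕ.+-∸-comm {n} (suc J) d≤n = trans (Σ0-cong (suc J) (λ t _ → trans (*-congˡ (U-multiple (N ℕ.+ suc J ∸ t)))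
        (solve 3 (λ a u l → a :* (u :* l) := u :* (a :* l)) refl _ (U k) _))) (sym (*-distribˡ-Σ0 (suc J) (U k) _))
      coefficient : (- 1#) ^ D * T ^ (D ∸ J) * invFact J * ((- 1#) ^ J * ι (J !) * S) ≈ S * (- T) ^ (D ∸ J)
      coefficient = begin
        (- 1#) ^ D * T ^ (D ∸ J) * invFact J * ((- 1#) ^ J * ι (J !) * S)
          ≈⟨ solve 6 (λ a t i b f S → a :* t :* i :* (b :* f :* S) := (a :* b) :* (f :* i) :* t :* S) refl _ _ _ _ _ _ ⟩
        ((- 1#) ^ D * (- 1#) ^ J) * (ι (J !) * invFact J) * T ^ (D ∸ J) * S
          ≈⟨ *-congʳ (*-congʳ (*-cong ([-1]^n*[-1]^m≈[-1]^[n∸m] J≤D) (inverseʳ (ι (J !)) _))) ⟩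
        (- 1#) ^ (D ∸ J) * 1# * T ^ (D ∸ J) * S
          ≈⟨ solve 3 (λ a t S → a :* con (+ 1) :* t :* S := S :* (a :* t)) refl _ _ _ ⟩
        S * ((- 1#) ^ (D ∸ J) * T ^ (D ∸ J))
          ≈⟨ *-congˡ (trans (sym (^-distrib-* (- 1#) T (D ∸ J))) (^-congˡ (D ∸ J) (-1*x≈-x T))) ⟩
        S * (- T) ^ (D ∸ J) ∎

mainTheorem4 : {c ℓ : Level} (F : Char0Field c ℓ) →
    let open Char0Field F in let open FieldOps F in
    (p q δ : Carrier) → (disc : ¬ (p * p - ι 4 * q ≈ 0#)) →
    (sq : δ * δ ≈ p * p - ι 4 * q) →
    let open Lucas p q δ (sqrt-nz p q δ sq disc) in
    (k : ℕ) → 1 ≤ k → (Uk≉0 : ¬ (U k ≈ 0#)) →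
    (d : ℕ) → 1 ≤ d → (n : ℕ) → d ≤ n →
    Σ0 d (λ j →
        (ι 4 * q ^ k) ^ (d ∸ j)
      * Σ0 j (λ i → (- 1#) ^ i * ι (j C i) * ι ((j +ℕ 1 ∸ i) ^ℕ d))
      * ((V k * V k - ι 4 * q ^ k) * inv (U k) Uk≉0) ^ j
      * s (j +ℕ 1) (n +ℕ j ∸ d) k)
    ≈
    Σ1 d (λ j →
        (- 1#) ^ (d ∸ 1) * (ι 2 * q ^ k) ^ (d ∸ j) * invFact (j ∸ 1)
      * Σ0 (j ∸ 1) (λ i → (- 1#) ^ i * ι ((j ∸ 1) C i) * ι ((i +ℕ 1) ^ℕ (d ∸ 1)))
      * Σ0 j (λ t →
            ι (j C t)
          * ((- (ι 2 * q ^ k)) ^ t * V k ^ (j ∸ t)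
             * Π1 j (λ i → ι (n +ℕ j ∸ d ∸ t) - ι i))
          * U ((n +ℕ j ∸ d ∸ t) *ℕ k)))
mainTheorem4 F p q δ disc sq k _ Uk≉0 zero () n d≤n
mainTheorem4 F p q δ disc sq k _ Uk≉0 (suc D) _ n d≤n = begin
  Σ0 (suc D) _                                     ≈⟨ Σ0-cong (suc D) (λ j _ → left-term Uk≉0 d≤n j) ⟩
  Σ0 (suc D) (λ j → U k * leftSummand (suc D) N j) ≈⟨ *-distribˡ-Σ0 (suc D) (U k) _ ⟨
  U k * Σ0 (suc D) (leftSummand (suc D) N)         ≈⟨ *-congˡ (lucas-coefficient-identity D N) ⟩
  U k * Σ0 D (rightSummand D N)                    ≈⟨ *-distribˡ-Σ0 D (U k) _ ⟩
  Σ0 D (λ J → U k * rightSummand D N J)            ≈⟨ Σ0-cong D (λ J J≤D → right-term d≤n J J≤D) ⟨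
  Σ0 D _                                           ≈⟨ Σ1-suc D _ ⟨
  Σ1 (suc D) _                                     ∎
  where
  open Char0Field F
  open FieldOps F using (sqrt-nz; module Lucas)
  open Lucas p q δ (sqrt-nz p q δ sq disc)
  open RingOpsProperties cring
  open LucasNumbers.Terms F p q δ (sqrt-nz p q δ sq disc) sq k
  open LucasCoefficients cring (V k) (q ^ k) using (lucas-coefficient-identity)
  open import Relation.Binary.Reasoning.Setoid setoid
  N = n ∸ suc D
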